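{- For every positive integer $n$, \[ \mathrm{FFW}_2(n) = \sum_{j=1}^{n-1} d(j) - d(n) + 1, \] \[ \mathrm{FFW}_3(n) = -\sum_{i = 1}^{n - 1} \left(\left\lfloor \frac{n - i - 1}{2}\right\rfloor - 1\right) d(i) - d(n) - n + \frac{1}{2} (-1)^n + \frac{5}{2}. \]
   Context: For a positive integer $n$, $\mathcal{D}(n)$ denotes the set of partitions of $n$ into distinct parts; for $\pi \in \mathcal{D}(n)$, $\#(\pi)$ is the number of parts of $\pi$ and $s_k(\pi)$ is the $k$th smallest part of $\pi$, with $s_k(\pi)=0$ if $\pi$ has fewer than $k$ parts. $\mathrm{FFW}_k(n) := \sum_{\pi \in \mathcal{D}(n)} (-1)^{\#(\pi)} s_k(\pi)$. $d(n)$ is the number of positive divisors of $n$. -}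

module Defs where

open import Data.Nat using (ℕ; zero; suc; _+_; _∸_; _≤?_)
open import Data.Nat.Divisibility using (_∣?_)
open import Data.List using (List; []; _∷_; map; concatMap; filter; length; foldr; applyUpTo)
open import Data.Integer as ℤ using (ℤ; +_)
open import Relation.Nullary.Decidable using (⌊_⌋)
open import Data.Bool using (if_then_else_)

-- A partition into distinct parts is represented as a strictly increasing
-- list of positive integers (smallest part first).

-- distinctFrom fuel lo n : all strictly increasing lists of integers ≥ lo
-- summing to n (fuel ≥ n guarantees completeness; lo ≥ 1 makes all parts positive).
distinctFrom : ℕ → ℕ → ℕ → List (List ℕ)
distinctFrom _        _  zero    = [] ∷ []
distinctFrom zero     _  (suc _) = []
distinctFrom (suc f) lo n@(suc _) =
  concatMap (λ p → if ⌊ lo Data.Nat.≤? p ⌋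
                     then map (p ∷_) (distinctFrom f (suc p) (n ∸ p))
                     else [])
            (applyUpTo suc n)

𝒟 : ℕ → List (List ℕ)
𝒟 n = distinctFrom n 1 n

-- s_k(π): k-th smallest part (k ≥ 1), 0 if π has fewer than k parts.
s : ℕ → List ℕ → ℕ
s _             []      = 0
s zero          _       = 0
s (suc zero)    (x ∷ _) = x
s (suc (suc k)) (_ ∷ xs) = s (suc k) xs

sumℤ : List ℤ → ℤ
sumℤ = foldr ℤ._+_ (+ 0)

Σ[1…_] : ℕ → (ℕ → ℤ) → ℤ
Σ[1… m ] f = sumℤ (map f (applyUpTo suc m))

sign : ℕ → ℤ
sign zero          = + 1
sign (suc zero)    = ℤ.- (+ 1)
sign (suc (suc m)) = sign m

FFW : ℕ → ℕ → ℤ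
FFW k n = sumℤ (map (λ π → sign (length π) ℤ.* (+ s k π)) (𝒟 n))

d : ℕ → ℕ
d n = length (filter (_∣? n) (applyUpTo suc n))

-- Generating functions are handled through their coefficient sequences on ℤ. Splitting off the
-- smallest part gives, for the generating function of Σ_π (-1)^#π s_k(π) over partitions into
-- distinct parts ≥ lo, a recursion in lo whose solution is a tail sum over the smallest part r
-- of terms q^(…) ∏_{i > r} (1 - qⁱ). Rearranging these tails (Abel summation, q-shifts) expresses
-- (1 - q) F₂ and (1 - q)(1 - q²) F₃ through K = Σ_r r qʳ ∏_{i > r} (1 - qⁱ) = -F₁:
--   (1 - q) F₂ = (2q - 1) K + q,   (1 - q)(1 - q²) F₃ = (-1 + 2q + q² - 3q³) K + q - 3q³.
-- K is the divisor generating function: ∏_{i > r} (1 - qⁱ) = (q)_∞ / (q)_r, and Σ_r r qʳ / (q)_r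
-- counts partitions weighted by their largest part, equivalently (conjugating) by their number
-- of parts, which is (1 / (q)_∞) Σ_{k, i ≥ 1} q^(ik). The closed forms satisfy the same
-- difference equations and initial values.

module Submission where

open import Defs
open import Data.Nat as ℕ using (ℕ; zero; suc; _∸_; _/_; _≤?_; z≤n; s≤s)
open import Data.Nat.Properties as ℕP using (_≟_) renaming (m<n⇒m<1+n to <-suc)
import Data.Nat.DivMod as DivMod
open import Data.Nat.Divisibility using (_∣_; _∣?_; divides)
open import Data.Integer as ℤ using (ℤ; +_; -[1+_]; _+_; _-_; _*_; -_; 0ℤ; 1ℤ)
import Data.Integer.Properties as ℤP
open import Data.List using (List; []; _∷_; map; concatMap; filter; length; applyUpTo; _++_)
import Data.List.Properties as ListP
open import Data.Bool using (Bool; true; false; if_then_else_)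
open import Data.Empty using (⊥-elim)
open import Data.Product using (_×_; _,_; proj₁)
open import Relation.Nullary using (¬_; Dec; does; yes; no)
open import Relation.Nullary.Decidable using (⌊_⌋)
open import Relation.Binary.Definitions using (tri<; tri≈; tri>)
open import Relation.Binary.PropositionalEquality
open import Function using (_∘_; id)
open import Data.Integer.Tactic.RingSolver using (solve-∀; solve)
open import Data.Nat.Tactic.RingSolver renaming (solve-∀ to ℕ-solve-∀) using ()

Σ< : ℕ → (ℕ → ℤ) → ℤ
Σ< zero    f = 0ℤ
Σ< (suc n) f = f 0 + Σ< n (f ∘ suc)

Σ<-cong : ∀ n {f g : ℕ → ℤ} → (∀ i → i ℕ.< n → f i ≡ g i) → Σ< n f ≡ Σ< n g
Σ<-cong zero    h = refl
Σ<-cong (suc n) h = cong₂ _+_ (h 0 (s≤s z≤n)) (Σ<-cong n (λ i p → h (suc i) (s≤s p)))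

Σ<-zero : ∀ n {f : ℕ → ℤ} → (∀ i → i ℕ.< n → f i ≡ 0ℤ) → Σ< n f ≡ 0ℤ
Σ<-zero zero    h = refl
Σ<-zero (suc n) h = cong₂ _+_ (h 0 (s≤s z≤n)) (Σ<-zero n (λ i p → h (suc i) (s≤s p)))

Σ<-+ : ∀ n (f g : ℕ → ℤ) → Σ< n (λ i → f i + g i) ≡ Σ< n f + Σ< n g
Σ<-+ zero    f g = refl
Σ<-+ (suc n) f g = trans (cong (_+_ (f 0 + g 0)) (Σ<-+ n (f ∘ suc) (g ∘ suc))) (interchange (f 0) (g 0) _ _)
  where interchange : ∀ a b c d → a + b + (c + d) ≡ a + c + (b + d)
        interchange = solve-∀

Σ<-neg : ∀ n (f : ℕ → ℤ) → Σ< n (λ i → - f i) ≡ - Σ< n f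
Σ<-neg zero    f = refl
Σ<-neg (suc n) f = trans (cong (_+_ (- f 0)) (Σ<-neg n (f ∘ suc))) (sym (ℤP.neg-distrib-+ (f 0) _))

Σ<-sub : ∀ n (f g : ℕ → ℤ) → Σ< n (λ i → f i - g i) ≡ Σ< n f - Σ< n g
Σ<-sub n f g = trans (Σ<-+ n f (λ i → - g i)) (cong (_+_ (Σ< n f)) (Σ<-neg n g))

Σ<-last : ∀ n (f : ℕ → ℤ) → Σ< (suc n) f ≡ Σ< n f + f n
Σ<-last zero    f = trans (ℤP.+-identityʳ (f 0)) (sym (ℤP.+-identityˡ (f 0)))
Σ<-last (suc n) f = trans (cong (_+_ (f 0)) (Σ<-last n (f ∘ suc))) (sym (ℤP.+-assoc (f 0) _ _))

Σ<-* : ∀ n c (f : ℕ → ℤ) → Σ< n (λ i → c * f i) ≡ c * Σ< n f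
Σ<-* zero    c f = sym (ℤP.*-zeroʳ c)
Σ<-* (suc n) c f = trans (cong (_+_ (c * f 0)) (Σ<-* n c (f ∘ suc))) (sym (ℤP.*-distribˡ-+ c (f 0) _))

Σ<-const : ∀ n c → Σ< n (λ _ → c) ≡ + n * c
Σ<-const zero    c = sym (ℤP.*-zeroˡ c)
Σ<-const (suc n) c = trans (cong (_+_ c) (Σ<-const n c)) (distrib c (+ n))
  where distrib : ∀ c m → c + m * c ≡ (1ℤ + m) * c
        distrib = solve-∀

Σ<-swap : ∀ n m (f : ℕ → ℕ → ℤ) → Σ< n (λ i → Σ< m (f i)) ≡ Σ< m (λ j → Σ< n (λ i → f i j))
Σ<-swap zero    m f = sym (Σ<-zero m (λ _ _ → refl))
Σ<-swap (suc n) m f = trans (cong (_+_ (Σ< m (f 0))) (Σ<-swap n m (f ∘ suc)))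
  (sym (Σ<-+ m (f 0) (λ j → Σ< n (λ i → f (suc i) j))))

Σ<-+-extend : ∀ m k (f : ℕ → ℤ) → (∀ i → m ℕ.≤ i → f i ≡ 0ℤ) → Σ< (m ℕ.+ k) f ≡ Σ< m f
Σ<-+-extend m zero    f f-vanish = cong (λ n → Σ< n f) (ℕP.+-identityʳ m)
Σ<-+-extend m (suc k) f f-vanish = begin
  Σ< (m ℕ.+ suc k) f      ≡⟨ cong (λ n → Σ< n f) (ℕP.+-suc m k) ⟩
  Σ< (suc (m ℕ.+ k)) f    ≡⟨ Σ<-last (m ℕ.+ k) f ⟩
  Σ< (m ℕ.+ k) f + f (m ℕ.+ k)  ≡⟨ cong₂ _+_ (Σ<-+-extend m k f f-vanish) (f-vanish (m ℕ.+ k) (ℕP.m≤m+n m k)) ⟩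
  Σ< m f + 0ℤ             ≡⟨ ℤP.+-identityʳ _ ⟩
  Σ< m f                  ∎
  where open ≡-Reasoning

Σ<-extend : ∀ m M (f : ℕ → ℤ) → m ℕ.≤ M → (∀ i → m ℕ.≤ i → f i ≡ 0ℤ) → Σ< M f ≡ Σ< m f
Σ<-extend m M f m≤M f-vanish = trans (cong (λ n → Σ< n f) (sym (ℕP.m+[n∸m]≡n m≤M))) (Σ<-+-extend m (M ∸ m) f f-vanish)

Σ<-single : ∀ N t (f : ℕ → ℤ) → t ℕ.< N → (∀ i → i ≢ t → f i ≡ 0ℤ) → Σ< N f ≡ f t
Σ<-single (suc N) zero    f _         others =
  trans (cong (_+_ (f 0)) (Σ<-zero N (λ i _ → others (suc i) (λ ())))) (ℤP.+-identityʳ _)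
Σ<-single (suc N) (suc t) f (s≤s t<N) others =
  trans (cong (_+ Σ< N (f ∘ suc)) (others 0 (λ ())))
        (trans (ℤP.+-identityˡ _) (Σ<-single N t (f ∘ suc) t<N (λ i i≢t → others (suc i) (i≢t ∘ ℕP.suc-injective))))

Σ<-by-parts : ∀ B (f : ℕ → ℤ) → Σ< B (λ j → + suc j * (f (suc j) - f j)) ≡ Σ< B (λ j → f B - f j)
Σ<-by-parts zero    f = refl
Σ<-by-parts (suc B) f = begin
  Σ< (suc B) (λ j → + suc j * (f (suc j) - f j))
    ≡⟨ Σ<-last B (λ j → + suc j * (f (suc j) - f j)) ⟩
  Σ< B (λ j → + suc j * (f (suc j) - f j)) + + suc B * Δf
    ≡⟨ cong (_+ + suc B * Δf) (Σ<-by-parts B f) ⟩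
  Σ< B (λ j → f B - f j) + + suc B * Δf
    ≡⟨ cong (_+_ (Σ< B (λ j → f B - f j))) (split (+ B) Δf) ⟩
  Σ< B (λ j → f B - f j) + (+ B * Δf + Δf)
    ≡⟨ cong (λ t → Σ< B (λ j → f B - f j) + (t + Δf)) (sym (Σ<-const B Δf)) ⟩
  Σ< B (λ j → f B - f j) + (Σ< B (λ _ → Δf) + Δf)
    ≡⟨ sym (ℤP.+-assoc (Σ< B (λ j → f B - f j)) _ _) ⟩
  Σ< B (λ j → f B - f j) + Σ< B (λ _ → Δf) + Δf
    ≡⟨ cong (_+ Δf) (sym (Σ<-+ B (λ j → f B - f j) (λ _ → Δf))) ⟩
  Σ< B (λ j → (f B - f j) + Δf) + Δf
    ≡⟨ cong (_+ Δf) (Σ<-cong B (λ j _ → telescope (f B) (f j) (f (suc B)))) ⟩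
  Σ< B (λ j → f (suc B) - f j) + (f (suc B) - f B)
    ≡⟨ sym (Σ<-last B (λ j → f (suc B) - f j)) ⟩
  Σ< (suc B) (λ j → f (suc B) - f j) ∎
  where open ≡-Reasoning
        Δf = f (suc B) - f B
        split : ∀ b c → (1ℤ + b) * c ≡ b * c + c
        split = solve-∀
        telescope : ∀ x y z → (x - y) + (z - x) ≡ z - y
        telescope = solve-∀

when : Bool → ℤ → ℤ
when true  x = x
when false x = 0ℤ

when-yes : ∀ {P : Set} (P? : Dec P) t → P → when ⌊ P? ⌋ t ≡ t
when-yes (yes _) t _ = refl
when-yes (no ¬p) t p = ⊥-elim (¬p p)

when-no : ∀ {P : Set} (P? : Dec P) t → ¬ P → when ⌊ P? ⌋ t ≡ 0ℤ
when-no (yes p) t ¬p = ⊥-elim (¬p p)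
when-no (no _)  t _  = refl

when-neg : ∀ b t → - when b t ≡ when b (- t)
when-neg true  t = refl
when-neg false t = refl

when-≤-split : ∀ l i t → when ⌊ suc l ≤? suc i ⌋ t ≡ when ⌊ suc (suc l) ≤? suc i ⌋ t + when ⌊ i ≟ l ⌋ t
when-≤-split l i t with ℕP.<-cmp i l
... | tri< i<l i≢l _
  rewrite when-no (suc l ≤? suc i) t (ℕP.<⇒≱ (s≤s i<l))
        | when-no (suc (suc l) ≤? suc i) t (ℕP.<⇒≱ (<-suc (s≤s i<l)))
        | when-no (i ≟ l) t i≢l = refl
... | tri≈ _ refl _
  rewrite when-yes (suc i ≤? suc i) t ℕP.≤-refl
        | when-no (suc (suc i) ≤? suc i) t ℕP.1+n≰n
        | when-yes (i ≟ i) t refl = sym (ℤP.+-identityˡ t)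
... | tri> _ i≢l l<i
  rewrite when-yes (suc l ≤? suc i) t (s≤s (ℕP.<⇒≤ l<i))
        | when-yes (suc (suc l) ≤? suc i) t (s≤s l<i)
        | when-no (i ≟ l) t i≢l = sym (ℤP.+-identityʳ t)

Σ<-indicator : ∀ N l (t : ℕ → ℤ) → Σ< N (λ i → when ⌊ i ≟ l ⌋ (t i)) ≡ when ⌊ suc l ≤? N ⌋ (t l)
Σ<-indicator N l t with suc l ≤? N
... | yes l<N = trans (Σ<-single N l _ l<N (λ i i≢l → when-no (i ≟ l) (t i) i≢l)) (when-yes (l ≟ l) (t l) refl)
... | no l≮N  = Σ<-zero N (λ i i<N → when-no (i ≟ l) (t i) (λ { refl → l≮N i<N }))

sumℤ-++ : ∀ xs ys → sumℤ (xs ++ ys) ≡ sumℤ xs + sumℤ ys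
sumℤ-++ []       ys = sym (ℤP.+-identityˡ _)
sumℤ-++ (x ∷ xs) ys = trans (cong (_+_ x) (sumℤ-++ xs ys)) (sym (ℤP.+-assoc x _ _))

sumℤ-concatMap : ∀ {A B : Set} (w : B → ℤ) (g : A → List B) xs →
  sumℤ (map w (concatMap g xs)) ≡ sumℤ (map (λ x → sumℤ (map w (g x))) xs)
sumℤ-concatMap w g []       = refl
sumℤ-concatMap w g (x ∷ xs) =
  trans (cong sumℤ (ListP.map-++ w (g x) (concatMap g xs)))
        (trans (sumℤ-++ (map w (g x)) _) (cong (_+_ (sumℤ (map w (g x)))) (sumℤ-concatMap w g xs)))

sumℤ-applyUpTo : ∀ (h : ℕ → ℤ) n → sumℤ (applyUpTo h n) ≡ Σ< n h
sumℤ-applyUpTo h zero    = refl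
sumℤ-applyUpTo h (suc n) = cong (_+_ (h 0)) (sumℤ-applyUpTo (h ∘ suc) n)

sumℤ-map-applyUpTo : ∀ {A : Set} (f : A → ℤ) (g : ℕ → A) n → sumℤ (map f (applyUpTo g n)) ≡ Σ< n (f ∘ g)
sumℤ-map-applyUpTo f g n = trans (cong sumℤ (ListP.map-applyUpTo g f n)) (sumℤ-applyUpTo (f ∘ g) n)

sumℤ-map-if : ∀ {A : Set} (w : A → ℤ) b L → sumℤ (map w (if b then L else [])) ≡ when b (sumℤ (map w L))
sumℤ-map-if w true  L = refl
sumℤ-map-if w false L = refl

sumℤ-map-neg : ∀ {A : Set} (w : A → ℤ) L → sumℤ (map (λ x → - w x) L) ≡ - sumℤ (map w L)
sumℤ-map-neg w []      = refl
sumℤ-map-neg w (x ∷ L) = trans (cong (_+_ (- w x)) (sumℤ-map-neg w L)) (sym (ℤP.neg-distrib-+ (w x) _))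

sumℤ-map-* : ∀ {A : Set} c (w : A → ℤ) L → sumℤ (map (λ x → c * w x) L) ≡ c * sumℤ (map w L)
sumℤ-map-* c w []      = sym (ℤP.*-zeroʳ c)
sumℤ-map-* c w (x ∷ L) = trans (cong (_+_ (c * w x)) (sumℤ-map-* c w L)) (sym (ℤP.*-distribˡ-+ c (w x) _))

Σ[1…]-suc : ∀ m f → Σ[1… suc m ] f ≡ Σ[1… m ] f + f (suc m)
Σ[1…]-suc m f = trans (sumℤ-map-applyUpTo f suc (suc m))
  (trans (Σ<-last m (f ∘ suc)) (cong (_+ f (suc m)) (sym (sumℤ-map-applyUpTo f suc m))))

cong₃ : ∀ {A B C D : Set} (f : A → B → C → D) {a a' b b' c c'} → a ≡ a' → b ≡ b' → c ≡ c' → f a b c ≡ f a' b' c'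
cong₃ f refl refl refl = refl

-≡⇒≡+ : ∀ {x y z} → x - y ≡ z → x ≡ z + y
-≡⇒≡+ {x} {y} refl = solve (x ∷ y ∷ [])

descend : (P : ℕ → Set) (N : ℕ) → (∀ lo → N ℕ.< lo → P lo) → (∀ lo → P (suc lo) → P lo) → ∀ lo → P lo
descend P N base step lo = go (suc N) lo (ℕP.m≤n+m (suc N) lo)
  where go : ∀ k lo → N ℕ.< lo ℕ.+ k → P lo
        go zero    lo N<lo = base lo (subst (N ℕ.<_) (ℕP.+-identityʳ lo) N<lo)
        go (suc k) lo N<lo = step lo (go k (suc lo) (subst (N ℕ.<_) (ℕP.+-suc lo k) N<lo))

third-order-agree : ∀ (f g : ℕ → ℤ) (next : ℕ → ℤ → ℤ → ℤ → ℤ) → f 0 ≡ g 0 → f 1 ≡ g 1 → f 2 ≡ g 2 →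
  (∀ n → f (3 ℕ.+ n) ≡ next n (f n) (f (1 ℕ.+ n)) (f (2 ℕ.+ n))) →
  (∀ n → g (3 ℕ.+ n) ≡ next n (g n) (g (1 ℕ.+ n)) (g (2 ℕ.+ n))) → ∀ n → f n ≡ g n
third-order-agree f g next f0≡g0 f1≡g1 f2≡g2 f-rec g-rec n = proj₁ (three n)
  where three : ∀ n → f n ≡ g n × f (1 ℕ.+ n) ≡ g (1 ℕ.+ n) × f (2 ℕ.+ n) ≡ g (2 ℕ.+ n)
        three zero    = f0≡g0 , f1≡g1 , f2≡g2
        three (suc n) with three n
        ... | fn≡gn , fn₁≡gn₁ , fn₂≡gn₂ =
          fn₁≡gn₁ , fn₂≡gn₂ , trans (f-rec n) (trans (cong₃ (next n) fn≡gn fn₁≡gn₁ fn₂≡gn₂) (sym (g-rec n)))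

-- Signed sums over partitions into distinct parts

Σ𝒟ᶠ : (List ℕ → ℤ) → ℕ → ℕ → ℕ → ℤ
Σ𝒟ᶠ w fuel lo n = sumℤ (map w (distinctFrom fuel lo n))

Σ𝒟ᶠ-unfold : ∀ w f lo m → Σ𝒟ᶠ w (suc f) lo (suc m) ≡
  Σ< (suc m) (λ i → when ⌊ lo ≤? suc i ⌋ (Σ𝒟ᶠ (w ∘ (suc i ∷_)) f (suc (suc i)) (m ∸ i)))
Σ𝒟ᶠ-unfold w f lo m =
  trans (sumℤ-concatMap w parts (applyUpTo suc (suc m)))
  (trans (sumℤ-map-applyUpTo (λ p → sumℤ (map w (parts p))) suc (suc m))
  (Σ<-cong (suc m) (λ i _ → trans (sumℤ-map-if w ⌊ lo ≤? suc i ⌋ (map (suc i ∷_) (distinctFrom f (suc (suc i)) (m ∸ i))))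
    (cong (when ⌊ lo ≤? suc i ⌋) (cong sumℤ (sym (ListP.map-∘ {g = w} {f = suc i ∷_} (distinctFrom f (suc (suc i)) (m ∸ i)))))))))
  where parts : ℕ → List (List ℕ)
        parts p = if ⌊ lo ≤? p ⌋ then map (p ∷_) (distinctFrom f (suc p) (suc m ∸ p)) else []

Σ𝒟ᶠ-fuel : ∀ w f g lo n → n ℕ.≤ f → n ℕ.≤ g → Σ𝒟ᶠ w f lo n ≡ Σ𝒟ᶠ w g lo n
Σ𝒟ᶠ-fuel w f g lo zero _ _ with f | g
... | zero  | zero  = refl
... | zero  | suc _ = refl
... | suc _ | zero  = refl
... | suc _ | suc _ = refl
Σ𝒟ᶠ-fuel w (suc f) (suc g) lo (suc m) (s≤s m≤f) (s≤s m≤g) =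
  trans (Σ𝒟ᶠ-unfold w f lo m) (trans (Σ<-cong (suc m) (λ i _ → cong (when ⌊ lo ≤? suc i ⌋)
    (Σ𝒟ᶠ-fuel (w ∘ (suc i ∷_)) f g (suc (suc i)) (m ∸ i) (ℕP.≤-trans (ℕP.m∸n≤m m i) m≤f) (ℕP.≤-trans (ℕP.m∸n≤m m i) m≤g))))
  (sym (Σ𝒟ᶠ-unfold w g lo m)))

Σ𝒟 : (List ℕ → ℤ) → ℕ → ℕ → ℤ
Σ𝒟 w lo n = Σ𝒟ᶠ w n lo n

Σ𝒟-unfold : ∀ w lo m → Σ𝒟 w lo (suc m) ≡
  Σ< (suc m) (λ i → when ⌊ lo ≤? suc i ⌋ (Σ𝒟 (w ∘ (suc i ∷_)) (suc (suc i)) (m ∸ i)))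
Σ𝒟-unfold w lo m = trans (Σ𝒟ᶠ-unfold w m lo m) (Σ<-cong (suc m) (λ i _ →
  cong (when ⌊ lo ≤? suc i ⌋) (Σ𝒟ᶠ-fuel (w ∘ (suc i ∷_)) m (m ∸ i) (suc (suc i)) (m ∸ i) (ℕP.m∸n≤m m i) ℕP.≤-refl)))

Σ𝒟-smallest : ∀ w l n → Σ𝒟 w (suc l) n ≡
  Σ𝒟 w (suc (suc l)) n + when ⌊ suc l ≤? n ⌋ (Σ𝒟 (w ∘ (suc l ∷_)) (suc (suc l)) (n ∸ suc l))
Σ𝒟-smallest w l zero    = sym (ℤP.+-identityʳ _)
Σ𝒟-smallest w l (suc m) = begin
  Σ𝒟 w (suc l) (suc m)
    ≡⟨ Σ𝒟-unfold w (suc l) m ⟩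
  Σ< (suc m) (λ i → when ⌊ suc l ≤? suc i ⌋ (t i))
    ≡⟨ Σ<-cong (suc m) (λ i _ → when-≤-split l i (t i)) ⟩
  Σ< (suc m) (λ i → when ⌊ suc (suc l) ≤? suc i ⌋ (t i) + when ⌊ i ≟ l ⌋ (t i))
    ≡⟨ Σ<-+ (suc m) (λ i → when ⌊ suc (suc l) ≤? suc i ⌋ (t i)) (λ i → when ⌊ i ≟ l ⌋ (t i)) ⟩
  Σ< (suc m) (λ i → when ⌊ suc (suc l) ≤? suc i ⌋ (t i)) + Σ< (suc m) (λ i → when ⌊ i ≟ l ⌋ (t i))
    ≡⟨ cong₂ _+_ (sym (Σ𝒟-unfold w (suc (suc l)) m)) (Σ<-indicator (suc m) l t) ⟩
  Σ𝒟 w (suc (suc l)) (suc m) + when ⌊ suc l ≤? suc m ⌋ (t l) ∎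
  where open ≡-Reasoning
        t : ℕ → ℤ
        t i = Σ𝒟 (w ∘ (suc i ∷_)) (suc (suc i)) (m ∸ i)

Σ𝒟-vanish : ∀ w lo m → suc m ℕ.< lo → Σ𝒟 w lo (suc m) ≡ 0ℤ
Σ𝒟-vanish w lo m m<lo = trans (Σ𝒟-unfold w lo m) (Σ<-zero (suc m) (λ i i≤m →
  when-no (lo ≤? suc i) (Σ𝒟 (w ∘ (suc i ∷_)) (suc (suc i)) (m ∸ i)) (λ lo≤i → ℕP.<-irrefl refl (ℕP.<-≤-trans m<lo (ℕP.≤-trans lo≤i i≤m)))))

Σ𝒟-cong : ∀ {w w'} → (∀ π → w π ≡ w' π) → ∀ lo n → Σ𝒟 w lo n ≡ Σ𝒟 w' lo n
Σ𝒟-cong w≗w' lo n = cong sumℤ (ListP.map-cong w≗w' (distinctFrom n lo n))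

Σ𝒟-neg : ∀ w lo n → Σ𝒟 (λ π → - w π) lo n ≡ - Σ𝒟 w lo n
Σ𝒟-neg w lo n = sumℤ-map-neg w (distinctFrom n lo n)

Σ𝒟-* : ∀ c w lo n → Σ𝒟 (λ π → c * w π) lo n ≡ c * Σ𝒟 w lo n
Σ𝒟-* c w lo n = sumℤ-map-* c w (distinctFrom n lo n)

sign-suc : ∀ m → sign (suc m) ≡ - sign m
sign-suc zero          = refl
sign-suc (suc zero)    = refl
sign-suc (suc (suc m)) = sign-suc m

signedCount : ℕ → ℕ → ℤ
signedCount = Σ𝒟 (sign ∘ length)

signedPart : ℕ → ℕ → ℕ → ℤ
signedPart k = Σ𝒟 (λ π → sign (length π) * + s k π)

signedCount-step : ∀ l n → signedCount (suc l) n ≡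
  signedCount (suc (suc l)) n + when ⌊ suc l ≤? n ⌋ (- signedCount (suc (suc l)) (n ∸ suc l))
signedCount-step l n = trans (Σ𝒟-smallest (sign ∘ length) l n)
  (cong (λ t → signedCount (suc (suc l)) n + when ⌊ suc l ≤? n ⌋ t)
    (trans (Σ𝒟-cong (sign-suc ∘ length) (suc (suc l)) (n ∸ suc l)) (Σ𝒟-neg (sign ∘ length) (suc (suc l)) (n ∸ suc l))))

signedPart₁-step : ∀ l n → signedPart 1 (suc l) n ≡
  signedPart 1 (suc (suc l)) n + when ⌊ suc l ≤? n ⌋ (- (+ suc l * signedCount (suc (suc l)) (n ∸ suc l)))
signedPart₁-step l n = trans (Σ𝒟-smallest _ l n)
  (cong (λ t → signedPart 1 (suc (suc l)) n + when ⌊ suc l ≤? n ⌋ t)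
    (trans (Σ𝒟-cong (λ π → trans (cong (_* + suc l) (sign-suc (length π))) (neg-*-comm (sign (length π)) (+ suc l))) L n')
    (trans (Σ𝒟-neg (λ π → + suc l * sign (length π)) L n') (cong -_ (Σ𝒟-* (+ suc l) (sign ∘ length) L n')))))
  where L = suc (suc l)
        n' = n ∸ suc l
        neg-*-comm : ∀ x y → - x * y ≡ - (y * x)
        neg-*-comm = solve-∀

signedPart-step : ∀ k l n → signedPart (suc (suc k)) (suc l) n ≡
  signedPart (suc (suc k)) (suc (suc l)) n + when ⌊ suc l ≤? n ⌋ (- signedPart (suc k) (suc (suc l)) (n ∸ suc l))
signedPart-step k l n = trans (Σ𝒟-smallest _ l n)
  (cong (λ t → signedPart (suc (suc k)) (suc (suc l)) n + when ⌊ suc l ≤? n ⌋ t)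
    (trans (Σ𝒟-cong (λ π → trans (cong (_* + s (suc k) π) (sign-suc (length π))) (sym (ℤP.neg-distribˡ-* (sign (length π)) (+ s (suc k) π)))) L n')
      (Σ𝒟-neg (λ π → sign (length π) * + s (suc k) π) L n')))
  where L = suc (suc l)
        n' = n ∸ suc l

_⁺ : ℤ → ℕ
(+ n)    ⁺ = n
-[1+ _ ] ⁺ = 0

-- A power series Σ aₙ qⁿ is represented by the sequence a on ℤ (zero at negative indices), so
-- that multiplication by q^c is the shift x ↦ x - c and needs no truncated subtraction.
causal : (ℕ → ℤ) → ℤ → ℤ
causal f (+ n)    = f n
causal f -[1+ _ ] = 0ℤ

IsCausal : (ℤ → ℤ) → Set
IsCausal f = ∀ k → f -[1+ k ] ≡ 0ℤ

causal-isCausal : ∀ f → IsCausal (causal f)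
causal-isCausal f k = refl

causal-* : ∀ c f x → causal (λ n → c * f n) x ≡ c * causal f x
causal-* c f (+ n)    = refl
causal-* c f -[1+ _ ] = sym (ℤP.*-zeroʳ c)

+-∸ : ∀ {k c} → c ℕ.≤ k → + k - + c ≡ + (k ∸ c)
+-∸ {k} {c} c≤k = trans (ℤP.m-n≡m⊖n k c) (ℤP.⊖-≥ c≤k)

+-< : ∀ {k c} → k ℕ.< c → + k - + c ≡ -[1+ (c ∸ suc k) ]
+-< {k} {c} k<c = trans (ℤP.m-n≡m⊖n k c) (trans (ℤP.⊖-< k<c) (cong (λ z → - (+ z)) (ℕP.+-∸-assoc 1 k<c)))

-[1+]-+ : ∀ k c → -[1+ k ] - + c ≡ -[1+ (k ℕ.+ c) ]
-[1+]-+ k zero    = cong -[1+_] (sym (ℕP.+-identityʳ k))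
-[1+]-+ k (suc c) = cong -[1+_] (sym (ℕP.+-suc k c))

shift-isCausal : ∀ f → IsCausal f → ∀ c → IsCausal (λ x → f (x - + c))
shift-isCausal f f-causal c k = trans (cong f (-[1+]-+ k c)) (f-causal _)

shift-eval : ∀ f → IsCausal f → ∀ k c → f (+ k - + c) ≡ when ⌊ c ≤? k ⌋ (f (+ (k ∸ c)))
shift-eval f f-causal k c with c ≤? k
... | yes c≤k = cong f (+-∸ c≤k)
... | no  c≰k = trans (cong f (+-< (ℕP.≰⇒> c≰k))) (f-causal _)

shift-vanish : ∀ f → IsCausal f → ∀ x c → x ⁺ ℕ.< c → f (x - + c) ≡ 0ℤ
shift-vanish f f-causal (+ k) c k<c =
  trans (shift-eval f f-causal k c) (when-no (c ≤? k) _ (ℕP.<⇒≱ k<c))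
shift-vanish f f-causal -[1+ k ] c _ = shift-isCausal f f-causal c k

⁺-shift : ∀ x c → (x - + c) ⁺ ℕ.≤ x ⁺
⁺-shift (+ k) c with c ≤? k
... | yes c≤k rewrite +-∸ c≤k = ℕP.m∸n≤m k c
... | no  c≰k rewrite +-< (ℕP.≰⇒> c≰k) = z≤n
⁺-shift -[1+ k ] c rewrite -[1+]-+ k c = z≤n

⁺-shift-< : ∀ x c {l} → x ⁺ ℕ.< l → (x - + c) ⁺ ℕ.< l
⁺-shift-< x c x<l = ℕP.≤-<-trans (⁺-shift x c) x<l

⁺-shift-suc : ∀ x c → (x - + suc c) ⁺ ℕ.≤ x ⁺ ∸ 1
⁺-shift-suc (+ zero)    c = ℕP.≤-reflexive (cong _⁺ (+-< {0} {suc c} (s≤s z≤n)))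
⁺-shift-suc (+ suc k)   c = subst (λ y → y ⁺ ℕ.≤ k) (sym suc-shift) (⁺-shift (+ k) c)
  where suc-shift : + suc k - + suc c ≡ + k - + c
        suc-shift = trans (ℤP.m-n≡m⊖n (suc k) (suc c)) (trans (ℤP.[1+m]⊖[1+n]≡m⊖n k c) (sym (ℤP.m-n≡m⊖n k c)))
⁺-shift-suc -[1+ k ]    c = z≤n

shift-shift : ∀ x a b → x - + a - + b ≡ x - + (a ℕ.+ b)
shift-shift x a b = trans (ℤP.+-assoc x (- + a) (- + b))
  (cong (_+_ x) (trans (sym (ℤP.neg-distrib-+ (+ a) (+ b))) (cong -_ (sym (ℤP.pos-+ a b)))))

shifts : ∀ (f : ℤ → ℤ) x a b {c} → a ℕ.+ b ≡ c → f (x - + a - + b) ≡ f (x - + c)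
shifts f x a b refl = cong f (shift-shift x a b)

shift-comm : ∀ x a b → x - + a - + b ≡ x - + b - + a
shift-comm x a b = trans (shift-shift x a b) (trans (cong (λ z → x - + z) (ℕP.+-comm a b)) (sym (shift-shift x b a)))

shift-suc : ∀ (f : ℤ → ℤ) x c → f (x - + c - + 1) ≡ f (x - + suc c)
shift-suc f x c = shifts f x c 1 (ℕP.+-comm c 1)

causal-step : ∀ (f g h : ℕ → ℤ) c → (∀ n → f n ≡ g n + when ⌊ c ≤? n ⌋ (- h (n ∸ c))) →
  ∀ x → causal f x ≡ causal g x - causal h (x - + c)
causal-step f g h c step (+ n) = trans (step n) (cong (_+_ (g n))
  (trans (sym (when-neg ⌊ c ≤? n ⌋ (h (n ∸ c)))) (cong -_ (sym (shift-eval (causal h) (causal-isCausal h) n c)))))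
causal-step f g h c step -[1+ k ] = sym (cong (λ z → 0ℤ - z) (shift-isCausal (causal h) (causal-isCausal h) c k))

δ : ℤ → ℤ
δ (+ zero)  = 1ℤ
δ (+ suc _) = 0ℤ
δ -[1+ _ ]  = 0ℤ

δ-isCausal : IsCausal δ
δ-isCausal k = refl

δ-shift-≢ : ∀ k i → i ≢ k → δ (+ k - + i) ≡ 0ℤ
δ-shift-≢ k i i≢k with i ≤? k
... | no  i≰k = cong δ (+-< (ℕP.≰⇒> i≰k))
... | yes i≤k with k ∸ i in k∸i≡
...   | zero  = ⊥-elim (i≢k (ℕP.≤-antisym i≤k (ℕP.m∸n≡0⇒m≤n k∸i≡)))
...   | suc _ = cong δ (trans (+-∸ i≤k) (cong +_ k∸i≡))

δ-shift-≡ : ∀ k → δ (+ k - + k) ≡ 1ℤ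
δ-shift-≡ k = cong δ (trans (+-∸ (ℕP.≤-refl {k})) (cong +_ (ℕP.n∸n≡0 k)))

periodic-causal-zero : ∀ f c → IsCausal f → (∀ x → f x ≡ f (x - + suc c)) → ∀ x → f x ≡ 0ℤ
periodic-causal-zero f c f-causal periodic x = go (x ⁺) x ℕP.≤-refl
  where go : ∀ n x → x ⁺ ℕ.≤ n → f x ≡ 0ℤ
        go zero    x x≤0 = trans (periodic x) (shift-vanish f f-causal x (suc c) (s≤s (ℕP.≤-trans x≤0 z≤n)))
        go (suc n) x x≤n = trans (periodic x) (go n (x - + suc c) (ℕP.≤-trans (⁺-shift-suc x c) (ℕP.∸-monoˡ-≤ 1 x≤n)))

-- multiplication by (1 - q)(1 - q²)
Δ : (ℤ → ℤ) → ℤ → ℤ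
Δ f x = f x - f (x - + 1) - f (x - + 2) + f (x - + 3)

Δ-step : ∀ f g h c → (∀ z → f z ≡ g z - h (z - + c)) → ∀ x → Δ f x ≡ Δ g x - Δ h (x - + c)
Δ-step f g h c f≡g-h x
  rewrite f≡g-h x | f≡g-h (x - + 1) | f≡g-h (x - + 2) | f≡g-h (x - + 3)
        | shift-comm x 1 c | shift-comm x 2 c | shift-comm x 3 c =
  rearrange (g x) (g (x - + 1)) (g (x - + 2)) (g (x - + 3)) (h (x - + c)) (h (x - + c - + 1)) (h (x - + c - + 2)) (h (x - + c - + 3))
  where rearrange : ∀ g₀ g₁ g₂ g₃ h₀ h₁ h₂ h₃ →
          g₀ - h₀ - (g₁ - h₁) - (g₂ - h₂) + (g₃ - h₃) ≡ g₀ - g₁ - g₂ + g₃ - (h₀ - h₁ - h₂ + h₃)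
        rearrange = solve-∀

-- E r is the coefficient sequence of ∏_{i ≥ r} (1 - qⁱ); the factor 1 - q⁰ makes E 0 vanish.
E : ℕ → ℤ → ℤ
E zero    = λ _ → 0ℤ
E (suc r) = causal (signedCount (suc r))

S : ℕ → ℕ → ℤ → ℤ
S k lo = causal (signedPart k lo)

E-isCausal : ∀ r → IsCausal (E r)
E-isCausal zero    k = refl
E-isCausal (suc r) k = refl

E-step : ∀ lo x → E lo x ≡ E (suc lo) x - E (suc lo) (x - + lo)
E-step zero    x = sym (trans (cong (λ z → E 1 x - E 1 z) (ℤP.+-identityʳ x)) (ℤP.+-inverseʳ (E 1 x)))
E-step (suc l) = causal-step _ _ _ (suc l) (signedCount-step l)

S₁-step : ∀ l x → S 1 (suc l) x ≡ S 1 (suc (suc l)) x - + suc l * E (suc (suc l)) (x - + suc l)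
S₁-step l x = trans (causal-step _ _ (λ n → + suc l * signedCount (suc (suc l)) n) (suc l) (signedPart₁-step l) x)
  (cong (λ t → S 1 (suc (suc l)) x - t) (causal-* (+ suc l) (signedCount (suc (suc l))) (x - + suc l)))

S-step : ∀ k l x → S (suc (suc k)) (suc l) x ≡ S (suc (suc k)) (suc (suc l)) x - S (suc k) (suc (suc l)) (x - + suc l)
S-step k l = causal-step _ _ _ (suc l) (signedPart-step k l)

S-vanish : ∀ k lo x → x ⁺ ℕ.< lo → S k lo x ≡ 0ℤ
S-vanish zero          lo (+ zero)  _ = refl
S-vanish (suc zero)    lo (+ zero)  _ = refl
S-vanish (suc (suc k)) lo (+ zero)  _ = refl
S-vanish k lo (+ suc m) m<lo = Σ𝒟-vanish _ lo m m<lo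
S-vanish k lo -[1+ _ ]  _    = refl

E-vanish : ∀ r x → x ⁺ ℕ.< r → E r x ≡ δ x
E-vanish (suc r) (+ zero)  _    = refl
E-vanish (suc r) (+ suc m) m<r  = Σ𝒟-vanish _ (suc r) m m<r
E-vanish (suc r) -[1+ _ ]  _    = refl

-- Identities between tails are proved by downward induction on lo (descend): both sides obey
-- the same recursion in lo and vanish once lo > x ⁺.
tail : (ℕ → ℤ → ℤ) → ℕ → ℤ → ℤ
tail F lo x = Σ< (suc (x ⁺) ∸ lo) (λ j → F (lo ℕ.+ j) x)

tail-vanish : ∀ F lo x → x ⁺ ℕ.< lo → tail F lo x ≡ 0ℤ
tail-vanish F lo x x<lo = cong (λ k → Σ< k (λ j → F (lo ℕ.+ j) x)) (ℕP.m≤n⇒m∸n≡0 x<lo)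

tail-step : ∀ F lo x → (∀ r → x ⁺ ℕ.< r → F r x ≡ 0ℤ) → tail F lo x ≡ F lo x + tail F (suc lo) x
tail-step F lo x F-vanish with lo ≤? x ⁺
... | yes lo≤x = trans (cong (λ k → Σ< k (λ j → F (lo ℕ.+ j) x)) (ℕP.+-∸-assoc 1 lo≤x))
   (cong₂ _+_ (cong (λ r → F r x) (ℕP.+-identityʳ lo))
     (Σ<-cong (x ⁺ ∸ lo) (λ j _ → cong (λ r → F r x) (ℕP.+-suc lo j))))
... | no  lo≰x = let x<lo = ℕP.≰⇒> lo≰x in
  trans (tail-vanish F lo x x<lo)
        (sym (cong₂ _+_ (F-vanish lo x<lo) (tail-vanish F (suc lo) x (<-suc x<lo))))

twice thrice : ℕ → ℕ
twice  r = r ℕ.+ r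
thrice r = r ℕ.+ r ℕ.+ r

Y-term Z-term : (ℕ → ℕ) → ℕ → ℤ → ℤ
Y-term g r x = + r * E (suc r) (x - + g r)
Z-term g r x = + r * E r (x - + g r)

V-term G-term H-term : ℕ → ℤ → ℤ
V-term r x = E r x - δ x
G-term r x = E r (x - + r)
H-term r x = + suc r * E r (x - + suc r)

Y Z : (ℕ → ℕ) → ℕ → ℤ → ℤ
Y g = tail (Y-term g)
Z g = tail (Z-term g)

V G H : ℕ → ℤ → ℤ
V = tail V-term
G = tail G-term
H = tail H-term

Y-step : ∀ g → (∀ r → r ℕ.≤ g r) → ∀ lo x → Y g lo x ≡ + lo * E (suc lo) (x - + g lo) + Y g (suc lo) x
Y-step g r≤g lo x = tail-step (Y-term g) lo x (λ r x<r → trans (cong (_*_ (+ r))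
  (shift-vanish (E (suc r)) (E-isCausal (suc r)) x (g r) (ℕP.<-≤-trans x<r (r≤g r)))) (ℤP.*-zeroʳ (+ r)))

Z-step : ∀ g → (∀ r → r ℕ.≤ g r) → ∀ lo x → Z g lo x ≡ + lo * E lo (x - + g lo) + Z g (suc lo) x
Z-step g r≤g lo x = tail-step (Z-term g) lo x (λ r x<r → trans (cong (_*_ (+ r))
  (shift-vanish (E r) (E-isCausal r) x (g r) (ℕP.<-≤-trans x<r (r≤g r)))) (ℤP.*-zeroʳ (+ r)))

Y-step-at : ∀ g → (∀ r → r ℕ.≤ g r) → ∀ lo x c {N} → c ℕ.+ g lo ≡ N →
  Y g lo (x - + c) ≡ + lo * E (suc lo) (x - + N) + Y g (suc lo) (x - + c)
Y-step-at g r≤g lo x c c+g≡N =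
  trans (Y-step g r≤g lo (x - + c)) (cong (λ t → + lo * t + Y g (suc lo) (x - + c)) (shifts (E (suc lo)) x c (g lo) c+g≡N))

V-step : ∀ lo x → V lo x ≡ (E lo x - δ x) + V (suc lo) x
V-step lo x = tail-step V-term lo x (λ r x<r → trans (cong (_- δ x) (E-vanish r x x<r)) (ℤP.+-inverseʳ (δ x)))

G-step : ∀ lo x → G lo x ≡ E lo (x - + lo) + G (suc lo) x
G-step lo x = tail-step G-term lo x (λ r x<r → shift-vanish (E r) (E-isCausal r) x r x<r)

H-step : ∀ lo x → H lo x ≡ + suc lo * E lo (x - + suc lo) + H (suc lo) x
H-step lo x = tail-step H-term lo x (λ r x<r → trans (cong (_*_ (+ suc r))
  (shift-vanish (E r) (E-isCausal r) x (suc r) (<-suc x<r))) (ℤP.*-zeroʳ (+ suc r)))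

≤-id : ∀ r → r ℕ.≤ id r
≤-id _ = ℕP.≤-refl

≤-twice : ∀ r → r ℕ.≤ twice r
≤-twice r = ℕP.m≤m+n r r

≤-thrice : ∀ r → r ℕ.≤ thrice r
≤-thrice r = ℕP.≤-trans (≤-twice r) (ℕP.m≤m+n (r ℕ.+ r) r)

Y-shift : ∀ g g' → (∀ r → g r ℕ.+ r ≡ g' r) → ∀ lo x → Y g' lo x ≡ Y g lo x - Z g lo x
Y-shift g g' g+r≡g' lo x = trans (Σ<-cong (suc (x ⁺) ∸ lo) (λ j _ → term (lo ℕ.+ j)))
  (Σ<-sub (suc (x ⁺) ∸ lo) (λ j → Y-term g (lo ℕ.+ j) x) (λ j → Z-term g (lo ℕ.+ j) x))
  where
  term : ∀ r → + r * E (suc r) (x - + g' r) ≡ + r * E (suc r) (x - + g r) - + r * E r (x - + g r)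
  term r = begin
    + r * E (suc r) (x - + g' r)
      ≡⟨ rearrange (+ r) (E (suc r) (x - + g r)) _ ⟩
    + r * E (suc r) (x - + g r) - + r * (E (suc r) (x - + g r) - E (suc r) (x - + g' r))
      ≡⟨ cong (λ t → + r * E (suc r) (x - + g r) - + r * (E (suc r) (x - + g r) - t)) (sym (shifts (E (suc r)) x (g r) r (g+r≡g' r))) ⟩
    + r * E (suc r) (x - + g r) - + r * (E (suc r) (x - + g r) - E (suc r) (x - + g r - + r))
      ≡⟨ cong (λ t → + r * E (suc r) (x - + g r) - + r * t) (sym (E-step r (x - + g r))) ⟩
    + r * E (suc r) (x - + g r) - + r * E r (x - + g r) ∎
    where open ≡-Reasoning
          rearrange : ∀ c a b → c * b ≡ c * a - c * (a - b)
          rearrange = solve-∀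

S₁≡-Y : ∀ l x → S 1 (suc l) x ≡ - Y id (suc l) x
S₁≡-Y l x = descend (λ l → S 1 (suc l) x ≡ - Y id (suc l) x) (x ⁺)
  (λ l x<l → trans (S-vanish 1 (suc l) x (<-suc x<l)) (sym (cong -_ (tail-vanish (Y-term id) (suc l) x (<-suc x<l)))))
  (λ l ih → combine (S₁-step l x) (Y-step id ≤-id (suc l) x) ih) l
  where combine : ∀ {s s' t y y'} → s ≡ s' - t → y ≡ t + y' → s' ≡ - y' → s ≡ - y
        combine {t = t} {y' = y'} refl refl refl = solve (t ∷ y' ∷ [])

-Y≡V : ∀ l x → - Y id l x ≡ + l * (E l x - δ x) + V (suc l) x
-Y≡V l x = descend (λ l → - Y id l x ≡ + l * (E l x - δ x) + V (suc l) x) (x ⁺)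
  (λ l x<l → vanishing (+ l) (tail-vanish (Y-term id) l x x<l) (E-vanish l x x<l) (tail-vanish V-term (suc l) x (<-suc x<l)))
  (λ l ih → combine (E (suc l) (x - + l)) (E (suc l) x) (δ x) (V (suc (suc l)) x) (+ l)
     (Y-step id ≤-id l x) (E-step l x) (V-step (suc l) x) (ℤP.pos-+ 1 l) ih) l
  where
  vanishing : ∀ {y e d v} c → y ≡ 0ℤ → e ≡ d → v ≡ 0ℤ → - y ≡ c * (e - d) + v
  vanishing {d = d} c refl refl refl = solve (d ∷ c ∷ [])
  combine : ∀ {y y' e v c'} t e' d v' c → y ≡ c * t + y' → e ≡ e' - t → v ≡ (e' - d) + v' → c' ≡ 1ℤ + c →
    - y' ≡ c' * (e' - d) + v' → - y ≡ c * (e - d) + v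
  combine {y' = y'} t e' d v' c refl refl refl refl ih =
    trans (cong (λ z → - (c * t + z)) (sym (ℤP.neg-involutive y'))) (trans (cong (λ z → - (c * t + - z)) ih)
      (solve (t ∷ e' ∷ d ∷ v' ∷ c ∷ [])))

S₂-difference : ∀ l x → S 2 (suc l) x - S 2 (suc l) (x - + 1) ≡ - S 1 (suc (suc l)) (x - + suc l) - Y twice (suc (suc l)) x
S₂-difference l x = descend P (x ⁺) base step l
  where
  P : ℕ → Set
  P l = S 2 (suc l) x - S 2 (suc l) (x - + 1) ≡ - S 1 (suc (suc l)) (x - + suc l) - Y twice (suc (suc l)) x
  base : ∀ l → x ⁺ ℕ.< l → P l
  base l x<l = trans (cong₂ _-_ (S-vanish 2 (suc l) x (<-suc x<l)) (S-vanish 2 (suc l) (x - + 1) (⁺-shift-< x 1 (<-suc x<l))))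
    (sym (cong₂ (λ s y → - s - y) (S-vanish 1 (suc (suc l)) (x - + suc l) (⁺-shift-< x (suc l) (<-suc (<-suc x<l))))
                                  (tail-vanish (Y-term twice) (suc (suc l)) x (<-suc (<-suc x<l)))))
  step : ∀ l → P (suc l) → P l
  step l ih = combine (S 2 L' x) (S 2 L' (x - + 1)) (S 1 L' (x - + L)) (S 1 L' (x - + L')) (S 1 L'' (x - + L'))
      (+ L') (E L'' (x - + (L' ℕ.+ L'))) (Y twice L'' x)
      (S-step 0 l x)
      (trans (S-step 0 l (x - + 1)) (cong (λ t → S 2 L' (x - + 1) - t) (shifts (S 1 L') x 1 L refl)))
      (trans (S₁-step L (x - + L')) (cong (λ t → S 1 L'' (x - + L') - + L' * t) (shifts (E L'') x L' L' refl)))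
      (Y-step twice ≤-twice L' x) (-≡⇒≡+ ih)
    where
    L L' L'' : ℕ
    L = suc l
    L' = suc L
    L'' = suc L'
    combine : ∀ {s s₁ y} s' s₁'' u v w c α y' → s ≡ s' - u → s₁ ≡ s₁'' - v → v ≡ w - c * α → y ≡ c * α + y' →
      s' ≡ (- w - y') + s₁'' → s - s₁ ≡ - u - y
    combine s' s₁'' u v w c α y' refl refl refl refl refl = solve (s₁'' ∷ u ∷ w ∷ c ∷ α ∷ y' ∷ [])

Z-id : ∀ l x → Z id (suc l) x ≡ + suc l * (δ (x - + 1) - E l (x - + 1)) - V (suc l) (x - + 1)
Z-id l x = descend P (x ⁺) base step l
  where
  P : ℕ → Set
  P l = Z id (suc l) x ≡ + suc l * (δ (x - + 1) - E l (x - + 1)) - V (suc l) (x - + 1)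
  base : ∀ l → x ⁺ ℕ.< l → P l
  base l x<l = vanishing (+ suc l) (tail-vanish (Z-term id) (suc l) x (<-suc x<l)) (E-vanish l (x - + 1) (⁺-shift-< x 1 x<l))
    (tail-vanish V-term (suc l) (x - + 1) (<-suc (⁺-shift-< x 1 x<l)))
    where vanishing : ∀ {z e d v} c → z ≡ 0ℤ → e ≡ d → v ≡ 0ℤ → z ≡ c * (d - e) - v
          vanishing {d = d} c refl refl refl = solve (d ∷ c ∷ [])
  step : ∀ l → P (suc l) → P l
  step l ih = combine (E (suc l) (x - + suc l)) (E (suc l) (x - + 1)) (δ (x - + 1)) (V (suc (suc l)) (x - + 1)) (+ suc l)
      (Z-step id ≤-id (suc l) x) (ℤP.pos-+ 1 (suc l)) ih
      (trans (E-step l (x - + 1)) (cong (λ t → E (suc l) (x - + 1) - t) (shifts (E (suc l)) x 1 l refl)))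
      (V-step (suc l) (x - + 1))
    where combine : ∀ {z z' e v c'} t e' d v' c → z ≡ c * t + z' → c' ≡ 1ℤ + c → z' ≡ c' * (d - e') - v' → e ≡ e' - t →
            v ≡ (e' - d) + v' → z ≡ c * (d - e) - v
          combine t e' d v' c refl refl refl refl refl = solve (t ∷ e' ∷ d ∷ v' ∷ c ∷ [])

G≡δ-E : ∀ l x → G (suc l) x ≡ δ (x - + 1) - E l (x - + 1)
G≡δ-E l x = descend (λ l → G (suc l) x ≡ δ (x - + 1) - E l (x - + 1)) (x ⁺)
  (λ l x<l → trans (tail-vanish G-term (suc l) x (<-suc x<l))
    (sym (trans (cong (_-_ (δ (x - + 1))) (E-vanish l (x - + 1) (⁺-shift-< x 1 x<l))) (ℤP.+-inverseʳ (δ (x - + 1))))))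
  (λ l ih → combine (E (suc l) (x - + suc l)) (E (suc l) (x - + 1)) (δ (x - + 1)) (G-step (suc l) x) ih
    (trans (E-step l (x - + 1)) (cong (λ t → E (suc l) (x - + 1) - t) (shifts (E (suc l)) x 1 l refl)))) l
  where combine : ∀ {g g' e} t e' d → g ≡ t + g' → g' ≡ d - e' → e ≡ e' - t → g ≡ d - e
        combine t e' d refl refl refl = solve (t ∷ e' ∷ d ∷ [])

H≡Z+G : ∀ lo x → H lo x ≡ Z id lo (x - + 1) + G lo (x - + 1)
H≡Z+G lo x = descend (λ lo → H lo x ≡ Z id lo (x - + 1) + G lo (x - + 1)) (x ⁺)
  (λ lo x<lo → trans (tail-vanish H-term lo x x<lo) (sym (cong₂ _+_
    (tail-vanish (Z-term id) lo (x - + 1) (⁺-shift-< x 1 x<lo)) (tail-vanish G-term lo (x - + 1) (⁺-shift-< x 1 x<lo)))))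
  (λ lo ih → combine (+ lo) (E lo (x - + suc lo)) (H-step lo x)
     (trans (Z-step id ≤-id lo (x - + 1)) (cong (λ t → + lo * t + Z id (suc lo) (x - + 1)) (shifts (E lo) x 1 lo refl)))
     (trans (G-step lo (x - + 1)) (cong (_+ G (suc lo) (x - + 1)) (shifts (E lo) x 1 lo refl)))
     (ℤP.pos-+ 1 lo) ih) lo
  where combine : ∀ {h h' z z' g g' c'} c t → h ≡ c' * t + h' → z ≡ c * t + z' → g ≡ t + g' → c' ≡ 1ℤ + c →
          h' ≡ z' + g' → h ≡ z + g
        combine {z' = z'} {g' = g'} c t refl refl refl refl refl = solve (z' ∷ g' ∷ c ∷ t ∷ [])

Z-twice : ∀ l x → Z twice (suc l) x ≡ Z id (suc l) (x - + 1) - H l (x - + 1)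
Z-twice l x = descend P (x ⁺) base step l
  where
  P : ℕ → Set
  P l = Z twice (suc l) x ≡ Z id (suc l) (x - + 1) - H l (x - + 1)
  base : ∀ l → x ⁺ ℕ.< l → P l
  base l x<l = trans (tail-vanish (Z-term twice) (suc l) x (<-suc x<l)) (sym (cong₂ _-_
    (tail-vanish (Z-term id) (suc l) (x - + 1) (<-suc (⁺-shift-< x 1 x<l))) (tail-vanish H-term l (x - + 1) (⁺-shift-< x 1 x<l))))
  step : ∀ l → P (suc l) → P l
  step l ih = combine (+ L) (E L (x - + suc L)) (E L (x - + (L ℕ.+ L)))
      (Z-step twice ≤-twice L x)
      (trans (Z-step id ≤-id L (x - + 1)) (cong (λ t → + L * t + Z id (suc L) (x - + 1)) (shifts (E L) x 1 L refl)))
      (trans (H-step l (x - + 1)) (cong (λ t → + L * t + H L (x - + 1)) (shifts (E l) x 1 L refl)))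
      (trans (E-step l (x - + suc L)) (cong (λ t → E L (x - + suc L) - t) (shifts (E L) x (suc L) l (cong suc (sym (ℕP.+-suc l l))))))
      ih
    where
    L : ℕ
    L = suc l
    combine : ∀ {y y' z z' h h' q} c p r → y ≡ c * r + y' → z ≡ c * p + z' → h ≡ c * q + h' → q ≡ p - r →
      y' ≡ z' - h' → y ≡ z - h
    combine {z' = z'} {h' = h'} c p r refl refl refl refl refl = solve (z' ∷ h' ∷ c ∷ p ∷ r ∷ [])

Δ-S₂ : ∀ l y → Δ (S 2 (suc l)) y ≡
  (- S 1 (suc (suc l)) (y - + suc l) - Y twice (suc (suc l)) y)
  - (- S 1 (suc (suc l)) (y - + 2 - + suc l) - Y twice (suc (suc l)) (y - + 2))
Δ-S₂ l y = begin
  Δ f y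
    ≡⟨ regroup (f y) (f (y - + 1)) (f (y - + 2)) (f (y - + 3)) ⟩
  (f y - f (y - + 1)) - (f (y - + 2) - f (y - + 3))
    ≡⟨ cong (λ t → (f y - f (y - + 1)) - (f (y - + 2) - t)) (sym (shifts f y 2 1 refl)) ⟩
  (f y - f (y - + 1)) - (f (y - + 2) - f (y - + 2 - + 1))
    ≡⟨ cong₂ _-_ (S₂-difference l y) (S₂-difference l (y - + 2)) ⟩
  _ ∎
  where open ≡-Reasoning
        f = S 2 (suc l)
        regroup : ∀ a b c d → a - b - c + d ≡ (a - b) - (c - d)
        regroup = solve-∀

S₃-tail : ℕ → ℤ → ℤ
S₃-tail l x = S 1 (suc (suc (suc l))) (x - + suc (suc l ℕ.+ suc l)) + Y twice (suc (suc (suc l))) (x - + suc l)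
  + Y twice (suc (suc (suc l))) (x - + suc (suc l)) - Y thrice (suc (suc (suc l))) x

S₃-difference-step : ∀ l x → Δ (S 3 (suc (suc l))) x ≡ S₃-tail (suc l) x → Δ (S 3 (suc l)) x ≡ S₃-tail l x
S₃-difference-step l x ih = combine
  (S 1 L'' (x - + suc (L ℕ.+ L))) (Y twice L'' (x - + L)) (S 1 L''' (x - + suc (L' ℕ.+ L')))
  (Y twice L''' (x - + L')) (Y twice L''' (x - + suc L')) (Y thrice L''' x)
  (+ L'') (E L''' (x - + (suc (L' ℕ.+ L') ℕ.+ L''))) (E L''' (x - + (L'' ℕ.+ (L'' ℕ.+ L''))))
  (Δ-step (S 3 L) (S 3 L') (S 2 L') L (S-step 1 l) x)
  (trans (Δ-S₂ L (x - + L)) (cong₃ (λ s₁a s₁b y₂b → (- s₁a - Y twice L'' (x - + L)) - (- s₁b - y₂b))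
    (shifts (S 1 L'') x L L' (ℕP.+-suc L L))
    (trans (cong (λ z → S 1 L'' (z - + L')) (shift-shift x L 2)) (shifts (S 1 L'') x (L ℕ.+ 2) L' (index₁ l)))
    (shifts (Y twice L'') x L 2 (ℕP.+-comm L 2))))
  ih
  (trans (S₁-step L' (x - + suc (L' ℕ.+ L'))) (cong (λ t → S 1 L''' (x - + suc (L' ℕ.+ L')) - + L'' * t)
    (shifts (E L''') x (suc (L' ℕ.+ L')) L'' refl)))
  (Y-step-at twice ≤-twice L'' x L' (index₂ l))
  (Y-step-at twice ≤-twice L'' x (suc L') refl)
  (trans (Y-step thrice ≤-thrice L'' x) (cong (λ t → + L'' * E L''' (x - + t) + Y thrice L''' x) (ℕP.+-assoc L'' L'' L'')))
  where
  L L' L'' L''' : ℕ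
  L = suc l
  L' = suc L
  L'' = suc L'
  L''' = suc L''
  index₁ : ∀ l → suc l ℕ.+ 2 ℕ.+ suc (suc l) ≡ suc (suc (suc l) ℕ.+ suc (suc l))
  index₁ = ℕ-solve-∀
  index₂ : ∀ l → suc (suc l) ℕ.+ (suc (suc (suc l)) ℕ.+ suc (suc (suc l))) ≡ suc (suc (suc l) ℕ.+ suc (suc l)) ℕ.+ suc (suc (suc l))
  index₂ = ℕ-solve-∀
  combine : ∀ {D D' ΔS₂ s₁b y₂b y₂c y₃} s₁a y₂a s₁' y₂a' y₂b' y₃' c α γ →
    D ≡ D' - ΔS₂ → ΔS₂ ≡ (- s₁a - y₂a) - (- s₁b - y₂b) → D' ≡ s₁' + y₂a' + y₂b' - y₃' →
    s₁b ≡ s₁' - c * α → y₂c ≡ c * α + y₂a' → y₂b ≡ c * γ + y₂b' → y₃ ≡ c * γ + y₃' →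
    D ≡ s₁a + y₂a + y₂c - y₃
  combine s₁a y₂a s₁' y₂a' y₂b' y₃' c α γ refl refl refl refl refl refl refl =
    solve (s₁a ∷ y₂a ∷ s₁' ∷ y₂a' ∷ y₂b' ∷ y₃' ∷ c ∷ α ∷ γ ∷ [])

S₃-difference : ∀ l x → Δ (S 3 (suc l)) x ≡ S₃-tail l x
S₃-difference l x = descend (λ l → Δ (S 3 (suc l)) x ≡ S₃-tail l x) (x ⁺) vanishing (λ l → S₃-difference-step l x) l
  where
  vanishing : ∀ l → x ⁺ ℕ.< l → Δ (S 3 (suc l)) x ≡ S₃-tail l x
  vanishing l x<l = all-zero (S-vanish 3 (suc l) x x<L) (S-vanish 3 (suc l) (x - + 1) (⁺-shift-< x 1 x<L))
    (S-vanish 3 (suc l) (x - + 2) (⁺-shift-< x 2 x<L)) (S-vanish 3 (suc l) (x - + 3) (⁺-shift-< x 3 x<L))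
    (S-vanish 1 L'' (x - + suc (suc l ℕ.+ suc l)) (⁺-shift-< x _ x<L''))
    (tail-vanish (Y-term twice) L'' (x - + suc l) (⁺-shift-< x (suc l) x<L''))
    (tail-vanish (Y-term twice) L'' (x - + suc (suc l)) (⁺-shift-< x (suc (suc l)) x<L''))
    (tail-vanish (Y-term thrice) L'' x x<L'')
    where
    L'' = suc (suc (suc l))
    x<L : x ⁺ ℕ.< suc l
    x<L = <-suc x<l
    x<L'' : x ⁺ ℕ.< L''
    x<L'' = <-suc (<-suc x<L)
    all-zero : ∀ {a b c d p q r s} → a ≡ 0ℤ → b ≡ 0ℤ → c ≡ 0ℤ → d ≡ 0ℤ → p ≡ 0ℤ → q ≡ 0ℤ → r ≡ 0ℤ → s ≡ 0ℤ →
      a - b - c + d ≡ p + q + r - s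
    all-zero refl refl refl refl refl refl refl refl = refl

-- Difference equations for FFW₂ and FFW₃

-- K = - FFW₁ by S₁≡-Y; K≡d below is the Fokkink–Fokkink–Wang identity FFW₁(n) = - d(n).
K : ℤ → ℤ
K = Y id 1

Y-id-0 : ∀ x → Y id 0 x ≡ K x
Y-id-0 x = trans (Y-step id ≤-id 0 x) (trans (cong (_+ K x) (ℤP.*-zeroˡ (E 1 (x - + 0)))) (ℤP.+-identityˡ _))

V-1 : ∀ x → V 1 x ≡ - K x
V-1 x = begin
  V 1 x                          ≡⟨ sym (ℤP.+-identityˡ (V 1 x)) ⟩
  + 0 * (E 0 x - δ x) + V 1 x    ≡⟨ sym (-Y≡V 0 x) ⟩
  - Y id 0 x                     ≡⟨ cong -_ (Y-id-0 x) ⟩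
  - K x                          ∎
  where open ≡-Reasoning

Z-id-1 : ∀ y → Z id 1 y ≡ δ (y - + 1) + K (y - + 1)
Z-id-1 y = begin
  Z id 1 y                                      ≡⟨ Z-id 0 y ⟩
  + 1 * (δ (y - + 1) - 0ℤ) - V 1 (y - + 1)      ≡⟨ cong (λ v → + 1 * (δ (y - + 1) - 0ℤ) - v) (V-1 (y - + 1)) ⟩
  + 1 * (δ (y - + 1) - 0ℤ) - - K (y - + 1)      ≡⟨ simplify (δ (y - + 1)) (K (y - + 1)) ⟩
  δ (y - + 1) + K (y - + 1)                     ∎
  where open ≡-Reasoning
        simplify : ∀ d k → + 1 * (d - 0ℤ) - - k ≡ d + k
        simplify = solve-∀

Y-twice-1 : ∀ y → Y twice 1 y ≡ K y - δ (y - + 1) - K (y - + 1)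
Y-twice-1 y = begin
  Y twice 1 y                                ≡⟨ Y-shift id twice (λ _ → refl) 1 y ⟩
  K y - Z id 1 y                             ≡⟨ cong (_-_ (K y)) (Z-id-1 y) ⟩
  K y - (δ (y - + 1) + K (y - + 1))          ≡⟨ simplify (K y) (δ (y - + 1)) (K (y - + 1)) ⟩
  K y - δ (y - + 1) - K (y - + 1)            ∎
  where open ≡-Reasoning
        simplify : ∀ k d k' → k - (d + k') ≡ k - d - k'
        simplify = solve-∀

S₂-1-difference : ∀ x → S 2 1 x - S 2 1 (x - + 1) ≡ + 2 * K (x - + 1) - K x + δ (x - + 1)
S₂-1-difference x = trans
  (combine (S 1 2 (x - + 1)) (Y twice 2 x) (Y id 2 (x - + 1)) (E 2 (x - + 2))
    (S₂-difference 0 x) (S₁≡-Y 1 (x - + 1))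
    (Y-step-at id ≤-id 1 x 1 refl)
    (Y-step twice ≤-twice 1 x))
  (eliminate (K (x - + 1)) (K x) (δ (x - + 1)) (Y-twice-1 x))
  where
  combine : ∀ {D k₁ y₂} s y y' e → D ≡ - s - y → s ≡ - y' → k₁ ≡ + 1 * e + y' → y₂ ≡ + 1 * e + y → D ≡ k₁ - y₂
  combine s y y' e refl refl refl refl = solve (y ∷ y' ∷ e ∷ [])
  eliminate : ∀ {y₂} k₁ k₀ d → y₂ ≡ k₀ - d - k₁ → k₁ - y₂ ≡ + 2 * k₁ - k₀ + d
  eliminate k₁ k₀ d refl = solve (k₁ ∷ k₀ ∷ d ∷ [])

Z-id-0 : ∀ x → Z id 0 x ≡ Z id 1 x
Z-id-0 x = trans (Z-step id ≤-id 0 x) (trans (cong (_+ Z id 1 x) (ℤP.*-zeroˡ (E 0 (x - + 0)))) (ℤP.+-identityˡ _))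

G-1 : ∀ y → G 1 y ≡ δ (y - + 1)
G-1 y = trans (G≡δ-E 0 y) (ℤP.+-identityʳ _)

H-0 : ∀ y → H 0 y ≡ Z id 1 (y - + 1) + G 1 (y - + 1)
H-0 y = trans (H≡Z+G 0 y) (cong₂ _+_ (Z-id-0 (y - + 1)) (ℤP.+-identityˡ _))

S₃-1-difference : ∀ x → Δ (S 3 1) x ≡
  - K x + + 2 * K (x - + 1) + K (x - + 2) - + 3 * K (x - + 3) + δ (x - + 1) - + 3 * δ (x - + 3)
S₃-1-difference x = trans
  (combine (Y twice 3 (x - + 1)) (Y twice 3 (x - + 2)) (Y thrice 3 x) (Y id 3 (x - + 3))
    (E 2 (x - + 4)) (E 3 (x - + 5)) (E 2 (x - + 3)) (E 3 (x - + 6))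
    (S₃-difference 0 x) (S₁≡-Y 2 (x - + 3))
    (Y-step-at id ≤-id 1 x 3 refl) (Y-step-at id ≤-id 2 x 3 refl)
    (Y-step-at twice ≤-twice 1 x 1 refl) (Y-step-at twice ≤-twice 2 x 1 refl)
    (Y-step-at twice ≤-twice 1 x 2 refl) (Y-step-at twice ≤-twice 2 x 2 refl)
    (Y-step thrice ≤-thrice 1 x) (Y-step thrice ≤-thrice 2 x))
  (eliminate (K x) (K (x - + 1)) (K (x - + 2)) (K (x - + 3)) (δ (x - + 1)) (δ (x - + 2)) (δ (x - + 3))
    (Y twice 1 x) (Z id 1 (x - + 1)) (Z id 1 (x - + 2)) (G 1 (x - + 2))
    (Y-twice-1-at 1) (Y-twice-1-at 2) (Y-shift twice thrice (λ _ → refl) 1 x) (Y-twice-1 x) (Z-twice 0 x)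
    (trans (Z-id-1 (x - + 1)) (cong₂ _+_ (shift-suc δ x 1) (shift-suc K x 1)))
    (trans (H-0 (x - + 1)) (cong₂ _+_ (cong (Z id 1) (shift-shift x 1 1)) (cong (G 1) (shift-shift x 1 1))))
    (trans (Z-id-1 (x - + 2)) (cong₂ _+_ (shift-suc δ x 2) (shift-suc K x 2)))
    (trans (G-1 (x - + 2)) (shift-suc δ x 2)))
  where
  Y-twice-1-at : ∀ c → Y twice 1 (x - + c) ≡ K (x - + c) - δ (x - + suc c) - K (x - + suc c)
  Y-twice-1-at c = trans (Y-twice-1 (x - + c)) (cong₂ (λ d k → K (x - + c) - d - k) (shift-suc δ x c) (shift-suc K x c))
  combine : ∀ {D s₁ k₃ y₁₂ y₂₁a y₂₂a y₂₁b y₂₂b y₃₁ y₃₂} y₂₃a y₂₃b y₃₃ y₁₃ a₄ b₅ a₃ b₆ →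
    D ≡ s₁ + y₂₃a + y₂₃b - y₃₃ → s₁ ≡ - y₁₃ → k₃ ≡ + 1 * a₄ + y₁₂ → y₁₂ ≡ + 2 * b₅ + y₁₃ →
    y₂₁a ≡ + 1 * a₃ + y₂₂a → y₂₂a ≡ + 2 * b₅ + y₂₃a → y₂₁b ≡ + 1 * a₄ + y₂₂b → y₂₂b ≡ + 2 * b₆ + y₂₃b →
    y₃₁ ≡ + 1 * a₃ + y₃₂ → y₃₂ ≡ + 2 * b₆ + y₃₃ →
    D ≡ - k₃ + y₂₁a + y₂₁b - y₃₁
  combine y₂₃a y₂₃b y₃₃ y₁₃ a₄ b₅ a₃ b₆ refl refl refl refl refl refl refl refl refl refl =
    solve (y₂₃a ∷ y₂₃b ∷ y₃₃ ∷ y₁₃ ∷ a₄ ∷ b₅ ∷ a₃ ∷ b₆ ∷ [])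
  eliminate : ∀ {y₂₁a y₂₁b y₃₁ z₂₁ h} k₀ k₁ k₂ k₃ d₁ d₂ d₃ y₂₁ z₁₁ z₁₂ g₁₂ →
    y₂₁a ≡ k₁ - d₂ - k₂ → y₂₁b ≡ k₂ - d₃ - k₃ → y₃₁ ≡ y₂₁ - z₂₁ → y₂₁ ≡ k₀ - d₁ - k₁ → z₂₁ ≡ z₁₁ - h →
    z₁₁ ≡ d₂ + k₂ → h ≡ z₁₂ + g₁₂ → z₁₂ ≡ d₃ + k₃ → g₁₂ ≡ d₃ →
    - k₃ + y₂₁a + y₂₁b - y₃₁ ≡ - k₀ + + 2 * k₁ + k₂ - + 3 * k₃ + d₁ - + 3 * d₃
  eliminate k₀ k₁ k₂ k₃ d₁ d₂ d₃ _ _ _ _ refl refl refl refl refl refl refl refl refl =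
    solve (k₀ ∷ k₁ ∷ k₂ ∷ k₃ ∷ d₁ ∷ d₂ ∷ d₃ ∷ [])

-- Gaussian binomials and partitions into bounded parts

-- gauss r s is the coefficient sequence of the Gaussian binomial [r + s choose r]_q.
gauss : ℕ → ℕ → ℤ → ℤ
gauss zero    s       x = δ x
gauss (suc r) zero    x = δ x
gauss (suc r) (suc s) x = gauss r (suc s) x + gauss (suc r) s (x - + suc r)

gauss-isCausal : ∀ r s → IsCausal (gauss r s)
gauss-isCausal zero    s       k = refl
gauss-isCausal (suc r) zero    k = refl
gauss-isCausal (suc r) (suc s) k =
  trans (cong₂ _+_ (gauss-isCausal r (suc s) k) (shift-isCausal (gauss (suc r) s) (gauss-isCausal (suc r) s) (suc r) k)) refl

gauss-zeroʳ : ∀ r x → gauss r 0 x ≡ δ x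
gauss-zeroʳ zero    x = refl
gauss-zeroʳ (suc r) x = refl

gauss-rec′ : ∀ r s x → gauss (suc r) (suc s) x ≡ gauss (suc r) s x + gauss r (suc s) (x - + suc s)
gauss-rec′ zero zero x = refl
gauss-rec′ zero (suc s) x = begin
  δ x + gauss 1 (suc s) (x - + 1)
    ≡⟨ cong (_+_ (δ x)) (gauss-rec′ zero s (x - + 1)) ⟩
  δ x + (gauss 1 s (x - + 1) + δ (x - + 1 - + suc s))
    ≡⟨ cong (λ t → δ x + (gauss 1 s (x - + 1) + t)) (shifts δ x 1 (suc s) refl) ⟩
  δ x + (gauss 1 s (x - + 1) + δ (x - + suc (suc s)))
    ≡⟨ sym (ℤP.+-assoc (δ x) _ _) ⟩
  δ x + gauss 1 s (x - + 1) + δ (x - + suc (suc s)) ∎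
  where open ≡-Reasoning
gauss-rec′ (suc r) zero x = begin
  gauss (suc r) 1 x + δ (x - + suc (suc r))
    ≡⟨ cong (_+ δ (x - + suc (suc r))) (gauss-rec′ r zero x) ⟩
  δ x + gauss r 1 (x - + 1) + δ (x - + suc (suc r))
    ≡⟨ ℤP.+-assoc (δ x) _ _ ⟩
  δ x + (gauss r 1 (x - + 1) + δ (x - + suc (suc r)))
    ≡⟨ cong (λ t → δ x + (gauss r 1 (x - + 1) + t)) (sym (shifts δ x 1 (suc r) refl)) ⟩
  δ x + gauss (suc r) 1 (x - + 1) ∎
  where open ≡-Reasoning
gauss-rec′ (suc r) (suc s) x = begin
  gauss (suc r) (suc (suc s)) x + gauss (suc (suc r)) (suc s) y
    ≡⟨ cong₂ _+_ (gauss-rec′ r (suc s) x) (gauss-rec′ (suc r) s y) ⟩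
  gauss (suc r) (suc s) x + gauss r (suc (suc s)) (x - + suc (suc s)) + (gauss (suc (suc r)) s y + gauss (suc r) (suc s) (y - + suc s))
    ≡⟨ cong (λ t → gauss (suc r) (suc s) x + gauss r (suc (suc s)) (x - + suc (suc s)) + (gauss (suc (suc r)) s y + t))
         (trans (shifts (gauss (suc r) (suc s)) x (suc (suc r)) (suc s) (swap r s))
                (sym (shifts (gauss (suc r) (suc s)) x (suc (suc s)) (suc r) refl))) ⟩
  gauss (suc r) (suc s) x + gauss r (suc (suc s)) (x - + suc (suc s)) + (gauss (suc (suc r)) s y + gauss (suc r) (suc s) (x - + suc (suc s) - + suc r))
    ≡⟨ interchange (gauss (suc r) (suc s) x) _ _ _ ⟩
  gauss (suc r) (suc s) x + gauss (suc (suc r)) s y + (gauss r (suc (suc s)) (x - + suc (suc s)) + gauss (suc r) (suc s) (x - + suc (suc s) - + suc r)) ∎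
  where open ≡-Reasoning
        y = x - + suc (suc r)
        swap : ∀ r s → suc (suc r) ℕ.+ suc s ≡ suc (suc s) ℕ.+ suc r
        swap = ℕ-solve-∀
        interchange : ∀ a b c d → a + b + (c + d) ≡ a + c + (b + d)
        interchange = solve-∀

gauss-sym : ∀ r s x → gauss r s x ≡ gauss s r x
gauss-sym zero    zero    x = refl
gauss-sym zero    (suc s) x = refl
gauss-sym (suc r) zero    x = refl
gauss-sym (suc r) (suc s) x =
  trans (cong₂ _+_ (gauss-sym r (suc s) x) (gauss-sym (suc r) s (x - + suc r))) (sym (gauss-rec′ s r x))

gauss-stable-suc : ∀ r s x → x ⁺ ℕ.≤ s → gauss r (suc s) x ≡ gauss r s x
gauss-stable-suc zero    s x _   = refl
gauss-stable-suc (suc r) s x x≤s = trans (gauss-rec′ r s x) (trans (cong (_+_ (gauss (suc r) s x))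
  (shift-vanish (gauss r (suc s)) (gauss-isCausal r (suc s)) x (suc s) (s≤s x≤s))) (ℤP.+-identityʳ _))

-- P≤ r is the coefficient sequence of 1 / ∏_{1 ≤ i ≤ r} (1 - qⁱ), i.e. partitions into parts ≤ r.
P≤ : ℕ → ℤ → ℤ
P≤ r x = gauss r (x ⁺) x

gauss-stable : ∀ r s x → x ⁺ ℕ.≤ s → gauss r s x ≡ P≤ r x
gauss-stable r s x x≤s = trans (cong (λ t → gauss r t x) (sym (ℕP.m+[n∸m]≡n x≤s))) (go (s ∸ x ⁺))
  where go : ∀ k → gauss r (x ⁺ ℕ.+ k) x ≡ P≤ r x
        go zero    = cong (λ t → gauss r t x) (ℕP.+-identityʳ (x ⁺))
        go (suc k) = trans (cong (λ t → gauss r t x) (ℕP.+-suc (x ⁺) k))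
          (trans (gauss-stable-suc r (x ⁺ ℕ.+ k) x (ℕP.m≤m+n (x ⁺) k)) (go k))

P≤-isCausal : ∀ r → IsCausal (P≤ r)
P≤-isCausal r k = gauss-isCausal r 0 k

P≤-rec : ∀ r x → P≤ (suc r) x ≡ P≤ r x + P≤ (suc r) (x - + suc r)
P≤-rec r -[1+ k ] = sym (cong₂ _+_ (gauss-zeroʳ r -[1+ k ]) (shift-isCausal (P≤ (suc r)) (P≤-isCausal (suc r)) (suc r) k))
P≤-rec r (+ zero) =
  sym (cong₂ _+_ (gauss-zeroʳ r (+ 0)) (shift-vanish (P≤ (suc r)) (P≤-isCausal (suc r)) (+ 0) (suc r) (s≤s z≤n)))
P≤-rec r (+ suc k) = cong (_+_ (gauss r (suc k) (+ suc k))) (gauss-stable (suc r) k (+ suc k - + suc r) (⁺-shift-suc (+ suc k) r))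

P≤-stable : ∀ r r' x → x ⁺ ℕ.≤ r → r ℕ.≤ r' → P≤ r' x ≡ P≤ r x
P≤-stable r r' x x≤r r≤r' = trans (cong (λ t → P≤ t x) (sym (ℕP.m+[n∸m]≡n r≤r'))) (go (r' ∸ r))
  where go : ∀ k → P≤ (r ℕ.+ k) x ≡ P≤ r x
        go zero    = cong (λ t → P≤ t x) (ℕP.+-identityʳ r)
        go (suc k) = trans (cong (λ t → P≤ t x) (ℕP.+-suc r k)) (trans (P≤-rec (r ℕ.+ k) x)
          (trans (cong (_+_ (P≤ (r ℕ.+ k) x)) (shift-vanish (P≤ (suc (r ℕ.+ k))) (P≤-isCausal (suc (r ℕ.+ k))) x (suc (r ℕ.+ k))
            (s≤s (ℕP.≤-trans x≤r (ℕP.m≤m+n r k))))) (trans (ℤP.+-identityʳ _) (go k))))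

_⋆_ : (ℤ → ℤ) → (ℤ → ℤ) → ℤ → ℤ
(f ⋆ g) x = Σ< (suc (x ⁺)) (λ j → f (+ j) * g (x - + j))

⋆-extend : ∀ f g → IsCausal g → ∀ x B → x ⁺ ℕ.< B → Σ< B (λ j → f (+ j) * g (x - + j)) ≡ (f ⋆ g) x
⋆-extend f g g-causal x B x<B = Σ<-extend (suc (x ⁺)) B _ x<B
  (λ j x<j → trans (cong (_*_ (f (+ j))) (shift-vanish g g-causal x j x<j)) (ℤP.*-zeroʳ (f (+ j))))

⋆-isCausal : ∀ f g → IsCausal g → IsCausal (f ⋆ g)
⋆-isCausal f g g-causal k =
  trans (cong (λ t → f (+ 0) * t + 0ℤ) (shift-isCausal g g-causal 0 k)) (trans (ℤP.+-identityʳ _) (ℤP.*-zeroʳ (f (+ 0))))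

⋆-δ : ∀ f → IsCausal f → ∀ x → (f ⋆ δ) x ≡ f x
⋆-δ f f-causal (+ k) = trans
  (Σ<-single (suc k) k (λ j → f (+ j) * δ (+ k - + j)) ℕP.≤-refl
    (λ j j≢k → trans (cong (_*_ (f (+ j))) (δ-shift-≢ k j j≢k)) (ℤP.*-zeroʳ (f (+ j)))))
  (trans (cong (_*_ (f (+ k))) (δ-shift-≡ k)) (ℤP.*-identityʳ _))
⋆-δ f f-causal -[1+ k ] = trans (⋆-isCausal f δ δ-isCausal k) (sym (f-causal k))

⋆-P≤-rec : ∀ f r x → (f ⋆ P≤ (suc r)) x ≡ (f ⋆ P≤ r) x + (f ⋆ P≤ (suc r)) (x - + suc r)
⋆-P≤-rec f r x = begin
  Σ< B (λ j → f (+ j) * P≤ (suc r) (x - + j))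
    ≡⟨ Σ<-cong B (λ j _ → trans (cong (_*_ (f (+ j))) (P≤-rec r (x - + j))) (ℤP.*-distribˡ-+ (f (+ j)) (P≤ r (x - + j)) (P≤ (suc r) (x - + j - + suc r)))) ⟩
  Σ< B (λ j → f (+ j) * P≤ r (x - + j) + f (+ j) * P≤ (suc r) (x - + j - + suc r))
    ≡⟨ Σ<-+ B (λ j → f (+ j) * P≤ r (x - + j)) (λ j → f (+ j) * P≤ (suc r) (x - + j - + suc r)) ⟩
  (f ⋆ P≤ r) x + Σ< B (λ j → f (+ j) * P≤ (suc r) (x - + j - + suc r))
    ≡⟨ cong (_+_ ((f ⋆ P≤ r) x)) (Σ<-cong B (λ j _ → cong (λ y → f (+ j) * P≤ (suc r) y) (shift-comm x j (suc r)))) ⟩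
  (f ⋆ P≤ r) x + Σ< B (λ j → f (+ j) * P≤ (suc r) (x - + suc r - + j))
    ≡⟨ cong (_+_ ((f ⋆ P≤ r) x)) (⋆-extend f (P≤ (suc r)) (P≤-isCausal (suc r)) (x - + suc r) B (s≤s (⁺-shift x (suc r)))) ⟩
  (f ⋆ P≤ r) x + (f ⋆ P≤ (suc r)) (x - + suc r) ∎
  where open ≡-Reasoning
        B = suc (x ⁺)

E≡E₁⋆P≤ : ∀ r x → E (suc r) x ≡ (E 1 ⋆ P≤ r) x
E≡E₁⋆P≤ zero    x = sym (⋆-δ (E 1) (E-isCausal 1) x)
E≡E₁⋆P≤ (suc r) x = ℤP.i-j≡0⇒i≡j _ _ (periodic-causal-zero difference r difference-isCausal difference-periodic x)
  where
  difference : ℤ → ℤ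
  difference y = E (suc (suc r)) y - (E 1 ⋆ P≤ (suc r)) y
  difference-isCausal : IsCausal difference
  difference-isCausal k = cong (_-_ 0ℤ) (⋆-isCausal (E 1) (P≤ (suc r)) (P≤-isCausal (suc r)) k)
  difference-periodic : ∀ y → difference y ≡ difference (y - + suc r)
  difference-periodic y = combine (E (suc (suc r)) y) (E (suc (suc r)) (y - + suc r)) ((E 1 ⋆ P≤ (suc r)) (y - + suc r))
    (trans (sym (E≡E₁⋆P≤ r y)) (E-step (suc r) y)) (⋆-P≤-rec (E 1) r y)
    where combine : ∀ {c c'} e e' d' → c' ≡ e - e' → c ≡ c' + d' → e - c ≡ e' - d'
          combine e e' d' refl refl = solve (e ∷ e' ∷ d' ∷ [])

-- K is the divisor function

-- The number of parts, summed over the partitions of x into parts ≤ R: the summand for s counts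
-- those with more than s parts.
partCountSum : ℕ → ℤ → ℤ
partCountSum R x = Σ< (x ⁺) (λ s → P≤ R x - gauss R s x)

partCountSum-vanish : ∀ R x → x ⁺ ≡ 0 → partCountSum R x ≡ 0ℤ
partCountSum-vanish R x x≡0 = cong (λ n → Σ< n (λ s → P≤ R x - gauss R s x)) x≡0

partCountSum-rec : ∀ R x → partCountSum (suc R) x ≡
  partCountSum R x + partCountSum (suc R) (x - + suc R) + P≤ (suc R) (x - + suc R)
partCountSum-rec R -[1+ k ] = sym (cong₂ (λ w p → 0ℤ + w + p)
  (partCountSum-vanish (suc R) (-[1+ k ] - + suc R) (ℕP.n≤0⇒n≡0 (⁺-shift-suc -[1+ k ] R)))
  (shift-vanish (P≤ (suc R)) (P≤-isCausal (suc R)) -[1+ k ] (suc R) (s≤s z≤n)))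
partCountSum-rec R (+ zero) = sym (cong₂ (λ w p → 0ℤ + w + p)
  (partCountSum-vanish (suc R) (+ 0 - + suc R) (ℕP.n≤0⇒n≡0 (⁺-shift-suc (+ 0) R)))
  (shift-vanish (P≤ (suc R)) (P≤-isCausal (suc R)) (+ 0) (suc R) (s≤s z≤n)))
partCountSum-rec R (+ suc k) = reassociate (partCountSum R x) (partCountSum (suc R) x') (P≤ (suc R) x') (begin
  Σ< (suc k) (λ s → P≤ (suc R) x - gauss (suc R) s x)
    ≡⟨ Σ<-cong (suc k) (λ s _ → split s) ⟩
  Σ< (suc k) (λ s → (P≤ R x - gauss R s x) + (P≤ (suc R) x' - gauss↓ s))
    ≡⟨ Σ<-+ (suc k) (λ s → P≤ R x - gauss R s x) (λ s → P≤ (suc R) x' - gauss↓ s) ⟩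
  partCountSum R x + ((P≤ (suc R) x' - 0ℤ) + Σ< k (λ s → P≤ (suc R) x' - gauss (suc R) s x'))
    ≡⟨ cong (λ t → partCountSum R x + (t + Σ< k (λ s → P≤ (suc R) x' - gauss (suc R) s x'))) (ℤP.+-identityʳ (P≤ (suc R) x')) ⟩
  partCountSum R x + (P≤ (suc R) x' + Σ< k (λ s → P≤ (suc R) x' - gauss (suc R) s x'))
    ≡⟨ cong (λ t → partCountSum R x + (P≤ (suc R) x' + t))
         (Σ<-extend (x' ⁺) k _ (⁺-shift-suc (+ suc k) R)
           (λ s x'≤s → trans (cong (_-_ (P≤ (suc R) x')) (gauss-stable (suc R) s x' x'≤s)) (ℤP.+-inverseʳ (P≤ (suc R) x')))) ⟩
  partCountSum R x + (P≤ (suc R) x' + partCountSum (suc R) x') ∎)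
  where
  open ≡-Reasoning
  x x' : ℤ
  x = + suc k
  x' = x - + suc R
  gauss↓ : ℕ → ℤ
  gauss↓ zero    = 0ℤ
  gauss↓ (suc s) = gauss (suc R) s x'
  split : ∀ s → P≤ (suc R) x - gauss (suc R) s x ≡ (P≤ R x - gauss R s x) + (P≤ (suc R) x' - gauss↓ s)
  split zero    = trans (cong₂ _-_ (P≤-rec R x) (sym (gauss-zeroʳ R x))) (rearrange (P≤ R x) (P≤ (suc R) x') (gauss R 0 x))
    where rearrange : ∀ a b c → a + b - c ≡ (a - c) + (b - 0ℤ)
          rearrange = solve-∀
  split (suc s) = trans (cong (_- gauss (suc R) (suc s) x) (P≤-rec R x)) (rearrange (P≤ R x) (P≤ (suc R) x') (gauss R (suc s) x) (gauss (suc R) s x'))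
    where rearrange : ∀ a b c d → a + b - (c + d) ≡ (a - c) + (b - d)
          rearrange = solve-∀
  reassociate : ∀ {w} a b p → w ≡ a + (p + b) → w ≡ a + b + p
  reassociate a b p refl = solve (a ∷ b ∷ p ∷ [])

P≤-geometric : ∀ R B y → y ⁺ ℕ.< B → P≤ (suc R) y ≡ Σ< B (λ i → P≤ R (y - + (i ℕ.* suc R)))
P≤-geometric R (suc zero) y y<1 = trans (P≤-rec R y) (cong₂ _+_ (cong (P≤ R) (sym (ℤP.+-identityʳ y)))
  (shift-vanish (P≤ (suc R)) (P≤-isCausal (suc R)) y (suc R) (ℕP.<-≤-trans y<1 (s≤s z≤n))))
P≤-geometric R (suc (suc B)) y y<B = trans (P≤-rec R y) (cong₂ _+_ (cong (P≤ R) (sym (ℤP.+-identityʳ y)))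
  (trans (P≤-geometric R (suc B) (y - + suc R) (s≤s (ℕP.≤-trans (⁺-shift-suc y R) (ℕP.∸-monoˡ-≤ 1 (ℕP.≤-pred y<B)))))
    (Σ<-cong (suc B) (λ i _ → cong (P≤ R) (shift-shift y (suc R) (i ℕ.* suc R))))))

P≤-geometric-shifted : ∀ R x → Σ< (x ⁺) (λ i → P≤ R (x - + (suc i ℕ.* suc R))) ≡ P≤ (suc R) (x - + suc R)
P≤-geometric-shifted R (+ zero)  = sym (shift-vanish (P≤ (suc R)) (P≤-isCausal (suc R)) (+ 0) (suc R) (s≤s z≤n))
P≤-geometric-shifted R -[1+ k ]  = sym (shift-vanish (P≤ (suc R)) (P≤-isCausal (suc R)) -[1+ k ] (suc R) (s≤s z≤n))
P≤-geometric-shifted R (+ suc k) = sym (trans (P≤-geometric R (suc k) (+ suc k - + suc R) (s≤s (⁺-shift-suc (+ suc k) R)))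
  (Σ<-cong (suc k) (λ i _ → cong (P≤ R) (shift-shift (+ suc k) (suc R) (i ℕ.* suc R)))))

multiplicitySum : ℕ → ℕ → ℤ → ℤ
multiplicitySum R B x = Σ< R (λ k → Σ< B (λ i → P≤ R (x - + (suc i ℕ.* suc k))))

multiplicitySum-rec : ∀ R x → multiplicitySum (suc R) (x ⁺) x ≡
  multiplicitySum R (x ⁺) x + multiplicitySum (suc R) ((x - + suc R) ⁺) (x - + suc R) + P≤ (suc R) (x - + suc R)
multiplicitySum-rec R x = reassociate (multiplicitySum R b x) (P≤ (suc R) x') (multiplicitySum (suc R) (x' ⁺) x') (begin
  Σ< (suc R) (λ k → Σ< b (λ i → P≤ (suc R) (x - + m i k)))
    ≡⟨ Σ<-cong (suc R) (λ k _ → Σ<-cong b (λ i _ → P≤-rec R (x - + m i k))) ⟩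
  Σ< (suc R) (λ k → Σ< b (λ i → P≤ R (x - + m i k) + P≤ (suc R) (x - + m i k - + suc R)))
    ≡⟨ Σ<-cong (suc R) (λ k _ → Σ<-+ b (λ i → P≤ R (x - + m i k)) (λ i → P≤ (suc R) (x - + m i k - + suc R))) ⟩
  Σ< (suc R) (λ k → Σ< b (λ i → P≤ R (x - + m i k)) + Σ< b (λ i → P≤ (suc R) (x - + m i k - + suc R)))
    ≡⟨ Σ<-+ (suc R) (λ k → Σ< b (λ i → P≤ R (x - + m i k))) (λ k → Σ< b (λ i → P≤ (suc R) (x - + m i k - + suc R))) ⟩
  Σ< (suc R) (λ k → Σ< b (λ i → P≤ R (x - + m i k))) + Σ< (suc R) (λ k → Σ< b (λ i → P≤ (suc R) (x - + m i k - + suc R)))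
    ≡⟨ cong₂ _+_ (trans (Σ<-last R (λ k → Σ< b (λ i → P≤ R (x - + m i k)))) (cong (_+_ (multiplicitySum R b x)) (P≤-geometric-shifted R x)))
         (Σ<-cong (suc R) (λ k _ → trans (Σ<-cong b (λ i _ → cong (P≤ (suc R)) (shift-comm x (m i k) (suc R))))
            (Σ<-extend (x' ⁺) b (λ i → P≤ (suc R) (x' - + m i k)) (⁺-shift x (suc R))
              (λ i x'≤i → shift-vanish (P≤ (suc R)) (P≤-isCausal (suc R)) x' (m i k) (ℕP.<-≤-trans (s≤s x'≤i) (ℕP.m≤m*n (suc i) (suc k))))))) ⟩
  multiplicitySum R b x + P≤ (suc R) x' + multiplicitySum (suc R) (x' ⁺) x' ∎)
  where
  open ≡-Reasoning
  b = x ⁺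
  x' = x - + suc R
  m : ℕ → ℕ → ℕ
  m i k = suc i ℕ.* suc k
  reassociate : ∀ {w} a p c → w ≡ a + p + c → w ≡ a + c + p
  reassociate a p c refl = solve (a ∷ p ∷ c ∷ [])

partCountSum≡multiplicitySum : ∀ R x → partCountSum R x ≡ multiplicitySum R (x ⁺) x
partCountSum≡multiplicitySum zero    x = Σ<-zero (x ⁺) (λ s _ → ℤP.+-inverseʳ (δ x))
partCountSum≡multiplicitySum (suc R) x = go (x ⁺) x ℕP.≤-refl
  where
  go : ∀ n x → x ⁺ ℕ.≤ n → partCountSum (suc R) x ≡ multiplicitySum (suc R) (x ⁺) x
  go zero    x x≤0 = let x≡0 = ℕP.n≤0⇒n≡0 x≤0 in
    trans (partCountSum-vanish (suc R) x x≡0)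
          (sym (Σ<-zero (suc R) (λ k _ → cong (λ n → Σ< n (λ i → P≤ (suc R) (x - + (suc i ℕ.* suc k)))) x≡0)))
  go (suc n) x x≤n = trans (partCountSum-rec R x)
    (trans (cong₂ (λ u v → u + v + P≤ (suc R) (x - + suc R)) (partCountSum≡multiplicitySum R x)
      (go n (x - + suc R) (ℕP.≤-trans (⁺-shift-suc x R) (ℕP.∸-monoˡ-≤ 1 x≤n))))
    (sym (multiplicitySum-rec R x)))

largestPartSum : ℕ → ℤ → ℤ
largestPartSum B x = Σ< B (λ j → + suc j * P≤ (suc j) (x - + suc j))

largestPartSum-extend : ∀ B x → x ⁺ ℕ.≤ B → largestPartSum B x ≡ largestPartSum (x ⁺) x
largestPartSum-extend B x x≤B = Σ<-extend (x ⁺) B (λ j → + suc j * P≤ (suc j) (x - + suc j)) x≤B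
  (λ j x≤j → trans (cong (_*_ (+ suc j)) (shift-vanish (P≤ (suc j)) (P≤-isCausal (suc j)) x (suc j) (s≤s x≤j)))
                   (ℤP.*-zeroʳ (+ suc j)))

largestPartSum≡partCountSum : ∀ x → largestPartSum (x ⁺) x ≡ partCountSum (x ⁺) x
largestPartSum≡partCountSum x = begin
  Σ< B (λ j → + suc j * P≤ (suc j) (x - + suc j))
    ≡⟨ Σ<-cong B (λ j _ → cong (_*_ (+ suc j)) (difference (P≤-rec j x))) ⟩
  Σ< B (λ j → + suc j * (P≤ (suc j) x - P≤ j x))
    ≡⟨ Σ<-by-parts B (λ j → P≤ j x) ⟩
  Σ< B (λ j → P≤ B x - P≤ j x)
    ≡⟨ Σ<-cong B (λ j _ → cong (_-_ (P≤ B x)) (gauss-sym j B x)) ⟩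
  partCountSum B x ∎
  where open ≡-Reasoning
        B = x ⁺
        difference : ∀ {p p' q} → p ≡ q + p' → p' ≡ p - q
        difference {p' = p'} {q} refl = solve (q ∷ p' ∷ [])

multiplicitySum-extend : ∀ y M → y ⁺ ℕ.≤ M → multiplicitySum (y ⁺) (y ⁺) y ≡ multiplicitySum M M y
multiplicitySum-extend y M y≤M = begin
  Σ< b (λ k → Σ< b (λ i → P≤ b (y - + m i k)))
    ≡⟨ Σ<-cong b (λ k _ → Σ<-cong b (λ i _ → sym (P≤-stable b M (y - + m i k) (⁺-shift y (m i k)) y≤M))) ⟩
  Σ< b (λ k → Σ< b (λ i → P≤ M (y - + m i k)))
    ≡⟨ Σ<-cong b (λ k _ → sym (Σ<-extend b M (λ i → P≤ M (y - + m i k)) y≤M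
         (λ i y≤i → vanish (ℕP.<-≤-trans (s≤s y≤i) (ℕP.m≤m*n (suc i) (suc k)))))) ⟩
  Σ< b (λ k → Σ< M (λ i → P≤ M (y - + m i k)))
    ≡⟨ sym (Σ<-extend b M (λ k → Σ< M (λ i → P≤ M (y - + m i k))) y≤M
         (λ k y≤k → Σ<-zero M (λ i _ → vanish (ℕP.<-≤-trans (s≤s y≤k) (ℕP.m≤n*m (suc k) (suc i)))))) ⟩
  multiplicitySum M M y ∎
  where open ≡-Reasoning
        b = y ⁺
        m : ℕ → ℕ → ℕ
        m i k = suc i ℕ.* suc k
        vanish : ∀ {c} → y ⁺ ℕ.< c → P≤ M (y - + c) ≡ 0ℤ
        vanish {c} = shift-vanish (P≤ M) (P≤-isCausal M) y c

Σ<-δ-multiples : ∀ m k → k ℕ.< m → Σ< m (λ i → δ (+ m - + (suc i ℕ.* suc k))) ≡ when (does (suc k ∣? m)) 1ℤ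
Σ<-δ-multiples m k k<m = count (suc k ∣? m)
  where
  count : (k∣?m : Dec (suc k ∣ m)) → Σ< m (λ i → δ (+ m - + (suc i ℕ.* suc k))) ≡ when (does k∣?m) 1ℤ
  count (no k∤m) = Σ<-zero m (λ i _ → δ-shift-≢ m (suc i ℕ.* suc k) (λ eq → k∤m (divides (suc i) (sym eq))))
  count (yes (divides zero m≡0)) = ⊥-elim (ℕP.<⇒≢ (ℕP.≤-<-trans z≤n k<m) (sym m≡0))
  count (yes (divides (suc t) m≡q*k)) = trans
    (Σ<-single m t (λ i → δ (+ m - + (suc i ℕ.* suc k))) t<m
      (λ i i≢t → δ-shift-≢ m (suc i ℕ.* suc k) (λ eq → i≢t (ℕP.suc-injective (ℕP.*-cancelʳ-≡ (suc i) (suc t) (suc k) (trans eq m≡q*k))))))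
    (trans (cong (λ c → δ (+ m - + c)) (sym m≡q*k)) (δ-shift-≡ m))
    where t<m : t ℕ.< m
          t<m = ℕP.<-≤-trans (ℕP.n<1+n t) (ℕP.≤-trans (ℕP.m≤m*n (suc t) (suc k)) (ℕP.≤-reflexive (sym m≡q*k)))

length-filter : ∀ m xs → + length (filter (_∣? m) xs) ≡ sumℤ (map (λ c → when (does (c ∣? m)) 1ℤ) xs)
length-filter m []       = refl
length-filter m (c ∷ xs) with does (c ∣? m)
... | true  = trans (ℤP.pos-+ 1 (length (filter (_∣? m) xs))) (cong (_+_ 1ℤ) (length-filter m xs))
... | false = trans (length-filter m xs) (sym (ℤP.+-identityˡ _))

d≡Σ< : ∀ m → + d m ≡ Σ< m (λ k → when (does (suc k ∣? m)) 1ℤ)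
d≡Σ< m = trans (length-filter m (applyUpTo suc m)) (sumℤ-map-applyUpTo (λ c → when (does (c ∣? m)) 1ℤ) suc m)

E₁⋆P≤-inverse : ∀ M y → y ⁺ ℕ.≤ M → Σ< (suc M) (λ i → E 1 (+ i) * P≤ M (y - + i)) ≡ δ y
E₁⋆P≤-inverse M y y≤M = trans (⋆-extend (E 1) (P≤ M) (P≤-isCausal M) y (suc M) (s≤s y≤M))
  (trans (sym (E≡E₁⋆P≤ M y)) (E-vanish (suc M) y (s≤s y≤M)))

Y-term-expand : ∀ j x B → x ⁺ ℕ.< B →
  + suc j * E (suc (suc j)) (x - + suc j) ≡ Σ< B (λ i → E 1 (+ i) * (+ suc j * P≤ (suc j) (x - + i - + suc j)))
Y-term-expand j x B x<B = begin
  + suc j * E (suc (suc j)) (x - + suc j)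
    ≡⟨ cong (_*_ (+ suc j)) (E≡E₁⋆P≤ (suc j) (x - + suc j)) ⟩
  + suc j * (E 1 ⋆ P≤ (suc j)) (x - + suc j)
    ≡⟨ cong (_*_ (+ suc j)) (sym (⋆-extend (E 1) (P≤ (suc j)) (P≤-isCausal (suc j)) (x - + suc j) B (ℕP.≤-<-trans (⁺-shift x (suc j)) x<B))) ⟩
  + suc j * Σ< B (λ i → E 1 (+ i) * P≤ (suc j) (x - + suc j - + i))
    ≡⟨ sym (Σ<-* B (+ suc j) (λ i → E 1 (+ i) * P≤ (suc j) (x - + suc j - + i))) ⟩
  Σ< B (λ i → + suc j * (E 1 (+ i) * P≤ (suc j) (x - + suc j - + i)))
    ≡⟨ Σ<-cong B (λ i _ → trans (cong (λ y → + suc j * (E 1 (+ i) * P≤ (suc j) y)) (shift-comm x (suc j) i))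
         (commute (+ suc j) (E 1 (+ i)) _)) ⟩
  Σ< B (λ i → E 1 (+ i) * (+ suc j * P≤ (suc j) (x - + i - + suc j))) ∎
  where open ≡-Reasoning
        commute : ∀ a b p → a * (b * p) ≡ b * (a * p)
        commute = solve-∀

largestPartSum≡multiplicitySum : ∀ M x → x ⁺ ℕ.≤ M → largestPartSum M x ≡ multiplicitySum M M x
largestPartSum≡multiplicitySum M x x≤M = trans (largestPartSum-extend M x x≤M)
  (trans (largestPartSum≡partCountSum x) (trans (partCountSum≡multiplicitySum (x ⁺) x) (multiplicitySum-extend x M x≤M)))

K≡d : ∀ m → K (+ m) ≡ + d m
K≡d m = begin
  Σ< m (λ j → + suc j * E (suc (suc j)) (+ m - + suc j))
    ≡⟨ Σ<-cong m (λ j _ → Y-term-expand j (+ m) (suc m) ℕP.≤-refl) ⟩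
  Σ< m (λ j → Σ< (suc m) (λ i → e i * (+ suc j * P≤ (suc j) (+ m - + i - + suc j))))
    ≡⟨ Σ<-swap m (suc m) (λ j i → e i * (+ suc j * P≤ (suc j) (+ m - + i - + suc j))) ⟩
  Σ< (suc m) (λ i → Σ< m (λ j → e i * (+ suc j * P≤ (suc j) (+ m - + i - + suc j))))
    ≡⟨ Σ<-cong (suc m) (λ i _ → Σ<-* m (e i) (λ j → + suc j * P≤ (suc j) (+ m - + i - + suc j))) ⟩
  Σ< (suc m) (λ i → e i * largestPartSum m (+ m - + i))
    ≡⟨ Σ<-cong (suc m) (λ i _ → cong (_*_ (e i)) (largestPartSum≡multiplicitySum m (+ m - + i) (⁺-shift (+ m) i))) ⟩
  Σ< (suc m) (λ i → e i * multiplicitySum m m (+ m - + i))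
    ≡⟨ Σ<-cong (suc m) (λ i _ → distribute i) ⟩
  Σ< (suc m) (λ i → Σ< m (λ k → Σ< m (λ i' → e i * P≤ m (+ m - + c i' k - + i))))
    ≡⟨ Σ<-swap (suc m) m (λ i k → Σ< m (λ i' → e i * P≤ m (+ m - + c i' k - + i))) ⟩
  Σ< m (λ k → Σ< (suc m) (λ i → Σ< m (λ i' → e i * P≤ m (+ m - + c i' k - + i))))
    ≡⟨ Σ<-cong m (λ k _ → Σ<-swap (suc m) m (λ i i' → e i * P≤ m (+ m - + c i' k - + i))) ⟩
  Σ< m (λ k → Σ< m (λ i' → Σ< (suc m) (λ i → e i * P≤ m (+ m - + c i' k - + i))))
    ≡⟨ Σ<-cong m (λ k _ → Σ<-cong m (λ i' _ → E₁⋆P≤-inverse m (+ m - + c i' k) (⁺-shift (+ m) (c i' k)))) ⟩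
  Σ< m (λ k → Σ< m (λ i' → δ (+ m - + c i' k)))
    ≡⟨ Σ<-cong m (λ k k<m → Σ<-δ-multiples m k k<m) ⟩
  Σ< m (λ k → when (does (suc k ∣? m)) 1ℤ)
    ≡⟨ sym (d≡Σ< m) ⟩
  + d m ∎
  where
  open ≡-Reasoning
  e : ℕ → ℤ
  e i = E 1 (+ i)
  c : ℕ → ℕ → ℕ
  c i k = suc i ℕ.* suc k
  distribute : ∀ i → e i * multiplicitySum m m (+ m - + i) ≡ Σ< m (λ k → Σ< m (λ i' → e i * P≤ m (+ m - + c i' k - + i)))
  distribute i = trans (sym (Σ<-* m (e i) (λ k → Σ< m (λ i' → P≤ m (+ m - + i - + c i' k)))))
    (Σ<-cong m (λ k _ → trans (sym (Σ<-* m (e i) (λ i' → P≤ m (+ m - + i - + c i' k))))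
      (Σ<-cong m (λ i' _ → cong (λ y → e i * P≤ m y) (shift-comm (+ m) i (c i' k))))))

FFW₂-difference : ∀ m → FFW 2 (suc (suc m)) - FFW 2 (suc m) ≡ + 2 * + d (suc m) - + d (suc (suc m)) + 0ℤ
FFW₂-difference m = begin
  S 2 1 x - S 2 1 (+ suc m)                     ≡⟨ cong (λ y → S 2 1 x - S 2 1 y) (sym x-1) ⟩
  S 2 1 x - S 2 1 (x - + 1)                     ≡⟨ S₂-1-difference x ⟩
  + 2 * K (x - + 1) - K x + δ (x - + 1)         ≡⟨ cong (λ y → + 2 * K y - K x + δ y) x-1 ⟩
  + 2 * K (+ suc m) - K x + δ (+ suc m)         ≡⟨ cong₂ (λ a b → + 2 * a - b + 0ℤ) (K≡d (suc m)) (K≡d (suc (suc m))) ⟩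
  + 2 * + d (suc m) - + d (suc (suc m)) + 0ℤ    ∎
  where open ≡-Reasoning
        x = + suc (suc m)
        x-1 : x - + 1 ≡ + suc m
        x-1 = +-∸ (s≤s z≤n)

FFW₂-formula : ∀ m → FFW 2 (suc m) ≡ Σ[1… m ] (λ j → + d j) - + d (suc m) + + 1
FFW₂-formula zero    = refl
FFW₂-formula (suc m) = combine (+ d (suc m)) (+ d (suc (suc m))) (Σ[1… m ] (λ j → + d j))
  (FFW₂-difference m) (FFW₂-formula m) (Σ[1…]-suc m (λ j → + d j))
  where
  combine : ∀ {F F' C'} a b C → F - F' ≡ + 2 * a - b + 0ℤ → F' ≡ C - a + 1ℤ → C' ≡ C + a → F ≡ C' - b + 1ℤ
  combine {F} a b C difference refl refl =
    trans (add-back F (C - a + 1ℤ)) (trans (cong (_+ (C - a + 1ℤ)) difference) (simplify a b C))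
    where add-back : ∀ F F' → F ≡ F - F' + F'
          add-back = solve-∀
          simplify : ∀ a b C → + 2 * a - b + 0ℤ + (C - a + 1ℤ) ≡ C + a - b + 1ℤ
          simplify = solve-∀

half-∸-step : ∀ p j → j ℕ.< p → (suc (suc p) ∸ j ∸ 1) / 2 ≡ suc ((p ∸ j ∸ 1) / 2)
half-∸-step (suc p) zero    _         = DivMod.m/n≡1+[m∸n]/n {suc (suc p)} {2} (s≤s (s≤s z≤n))
half-∸-step (suc p) (suc j) (s≤s j<p) = half-∸-step p j j<p

Q : ℕ → ℤ
Q n = Σ[1… n ∸ 1 ] (λ i → (+ ((n ∸ i ∸ 1) / 2) - + 1) * + d i)

Q-rec : ∀ p → Q (suc (suc (suc p))) ≡ Q (suc p) + Σ[1… p ] (λ j → + d j) - + d (suc p) - + d (suc (suc p))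
Q-rec p = begin
  Q (suc (suc (suc p)))
    ≡⟨ sumℤ-map-applyUpTo w suc (suc (suc p)) ⟩
  Σ< (suc (suc p)) (w ∘ suc)
    ≡⟨ trans (Σ<-last (suc p) (w ∘ suc)) (cong (_+ w (suc (suc p))) (Σ<-last p (w ∘ suc))) ⟩
  Σ< p (w ∘ suc) + w (suc p) + w (suc (suc p))
    ≡⟨ cong₂ (λ a b → Σ< p (w ∘ suc) + a + b) (last-coefficient (suc p) (ℕP.m+n∸n≡m 2 p) refl) (last-coefficient (suc (suc p)) (ℕP.m+n∸n≡m 1 p) refl) ⟩
  Σ< p (w ∘ suc) + (+ 0 - + 1) * + d (suc p) + (+ 0 - + 1) * + d (suc (suc p))
    ≡⟨ cong (λ s → s + (+ 0 - + 1) * + d (suc p) + (+ 0 - + 1) * + d (suc (suc p))) earlier-terms ⟩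
  Q (suc p) + Σ[1… p ] (λ j → + d j) + (+ 0 - + 1) * + d (suc p) + (+ 0 - + 1) * + d (suc (suc p))
    ≡⟨ simplify (Q (suc p)) (Σ[1… p ] (λ j → + d j)) (+ d (suc p)) (+ d (suc (suc p))) ⟩
  Q (suc p) + Σ[1… p ] (λ j → + d j) - + d (suc p) - + d (suc (suc p)) ∎
  where
  open ≡-Reasoning
  w : ℕ → ℤ
  w i = (+ ((suc (suc (suc p)) ∸ i ∸ 1) / 2) - + 1) * + d i
  w′ : ℕ → ℤ
  w′ i = (+ ((suc p ∸ i ∸ 1) / 2) - + 1) * + d i
  last-coefficient : ∀ i {k} → suc (suc (suc p)) ∸ i ≡ k → (k ∸ 1) / 2 ≡ 0 → w i ≡ (+ 0 - + 1) * + d i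
  last-coefficient i refl half≡0 = cong (λ z → (+ z - + 1) * + d i) half≡0
  shift-coefficient : ∀ j → j ℕ.< p → w (suc j) ≡ w′ (suc j) + + d (suc j)
  shift-coefficient j j<p = trans (cong (λ z → (+ z - + 1) * + d (suc j)) (half-∸-step p j j<p))
    (distrib (+ ((p ∸ j ∸ 1) / 2)) (+ d (suc j)))
    where distrib : ∀ y e → (1ℤ + y - + 1) * e ≡ (y - + 1) * e + e
          distrib = solve-∀
  earlier-terms : Σ< p (w ∘ suc) ≡ Q (suc p) + Σ[1… p ] (λ j → + d j)
  earlier-terms = trans (Σ<-cong p (λ j j<p → shift-coefficient j j<p))
    (trans (Σ<-+ p (w′ ∘ suc) (λ j → + d (suc j)))
      (sym (cong₂ _+_ (sumℤ-map-applyUpTo w′ suc p) (sumℤ-map-applyUpTo (λ j → + d j) suc p))))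
  simplify : ∀ q c a b → q + c + (+ 0 - + 1) * a + (+ 0 - + 1) * b ≡ q + c - a - b
  simplify = solve-∀

FFW₃-next : ℕ → ℤ → ℤ → ℤ → ℤ
FFW₃-next n a b c = + 2 * (- + d (4 ℕ.+ n) + + 2 * + d (3 ℕ.+ n) + + d (2 ℕ.+ n) - + 3 * + d (1 ℕ.+ n)) + c + b - a

FFW₃-rec : ∀ n → + 2 * FFW 3 (4 ℕ.+ n) ≡ FFW₃-next n (+ 2 * FFW 3 (1 ℕ.+ n)) (+ 2 * FFW 3 (2 ℕ.+ n)) (+ 2 * FFW 3 (3 ℕ.+ n))
FFW₃-rec n = solve-for-top (FFW 3 (4 ℕ.+ n)) (FFW 3 (3 ℕ.+ n)) (FFW 3 (2 ℕ.+ n)) (FFW 3 (1 ℕ.+ n)) (begin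
  S 3 1 x - S 3 1 (+ (3 ℕ.+ n)) - S 3 1 (+ (2 ℕ.+ n)) + S 3 1 (+ (1 ℕ.+ n))
    ≡⟨ cong₃ (λ u v w → S 3 1 x - S 3 1 u - S 3 1 v + S 3 1 w) (sym x-1) (sym x-2) (sym x-3) ⟩
  Δ (S 3 1) x
    ≡⟨ S₃-1-difference x ⟩
  - K x + + 2 * K (x - + 1) + K (x - + 2) - + 3 * K (x - + 3) + δ (x - + 1) - + 3 * δ (x - + 3)
    ≡⟨ cong₃ (λ u v w → - K x + + 2 * K u + K v - + 3 * K w + δ u - + 3 * δ w) x-1 x-2 x-3 ⟩
  - K x + + 2 * K (+ (3 ℕ.+ n)) + K (+ (2 ℕ.+ n)) - + 3 * K (+ (1 ℕ.+ n)) + 0ℤ - + 3 * 0ℤ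
    ≡⟨ drop-zeros _ ⟩
  - K x + + 2 * K (+ (3 ℕ.+ n)) + K (+ (2 ℕ.+ n)) - + 3 * K (+ (1 ℕ.+ n))
    ≡⟨ cong₂ (λ a b → - a + + 2 * b + K (+ (2 ℕ.+ n)) - + 3 * K (+ (1 ℕ.+ n))) (K≡d (4 ℕ.+ n)) (K≡d (3 ℕ.+ n)) ⟩
  - + d (4 ℕ.+ n) + + 2 * + d (3 ℕ.+ n) + K (+ (2 ℕ.+ n)) - + 3 * K (+ (1 ℕ.+ n))
    ≡⟨ cong₂ (λ a b → - + d (4 ℕ.+ n) + + 2 * + d (3 ℕ.+ n) + a - + 3 * b) (K≡d (2 ℕ.+ n)) (K≡d (1 ℕ.+ n)) ⟩
  - + d (4 ℕ.+ n) + + 2 * + d (3 ℕ.+ n) + + d (2 ℕ.+ n) - + 3 * + d (1 ℕ.+ n) ∎)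
  where
  open ≡-Reasoning
  x = + (4 ℕ.+ n)
  x-1 : x - + 1 ≡ + (3 ℕ.+ n)
  x-1 = +-∸ (s≤s z≤n)
  x-2 : x - + 2 ≡ + (2 ℕ.+ n)
  x-2 = +-∸ (s≤s (s≤s z≤n))
  x-3 : x - + 3 ≡ + (1 ℕ.+ n)
  x-3 = +-∸ (s≤s (s≤s (s≤s z≤n)))
  drop-zeros : ∀ r → r + 0ℤ - + 3 * 0ℤ ≡ r
  drop-zeros r = trans (ℤP.+-identityʳ (r + 0ℤ)) (ℤP.+-identityʳ r)
  solve-for-top : ∀ {X} f₄ f₃ f₂ f₁ → f₄ - f₃ - f₂ + f₁ ≡ X → + 2 * f₄ ≡ + 2 * X + + 2 * f₃ + + 2 * f₂ - + 2 * f₁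
  solve-for-top f₄ f₃ f₂ f₁ refl = solve (f₄ ∷ f₃ ∷ f₂ ∷ f₁ ∷ [])

FFW₃-formula : ℕ → ℤ
FFW₃-formula n = + 2 * (- Q n - + d n - + n) + sign n + + 5

FFW₃-formula-rec : ∀ n → FFW₃-formula (4 ℕ.+ n) ≡
  FFW₃-next n (FFW₃-formula (1 ℕ.+ n)) (FFW₃-formula (2 ℕ.+ n)) (FFW₃-formula (3 ℕ.+ n))
FFW₃-formula-rec n = combine (Q (1 ℕ.+ n)) (Q (2 ℕ.+ n)) (Σ[1… n ] (λ j → + d j))
  (+ d (1 ℕ.+ n)) (+ d (2 ℕ.+ n)) (+ d (3 ℕ.+ n)) (+ d (4 ℕ.+ n)) (sign n) (sign (1 ℕ.+ n)) (+ (1 ℕ.+ n))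
  (Q-rec (1 ℕ.+ n)) (Q-rec n) (Σ[1…]-suc n (λ j → + d j))
  (ℤP.pos-+ 1 (1 ℕ.+ n)) (ℤP.pos-+ 1 (2 ℕ.+ n)) (ℤP.pos-+ 1 (3 ℕ.+ n))
  where
  combine : ∀ {q₃ q₄ c' n₂ n₃ n₄} q₁ q₂ c d₁ d₂ d₃ d₄ s₀ s₁ n₁ →
    q₄ ≡ q₂ + c' - d₂ - d₃ → q₃ ≡ q₁ + c - d₁ - d₂ → c' ≡ c + d₁ →
    n₂ ≡ 1ℤ + n₁ → n₃ ≡ 1ℤ + n₂ → n₄ ≡ 1ℤ + n₃ →
    + 2 * (- q₄ - d₄ - n₄) + s₀ + + 5 ≡
      + 2 * (- d₄ + + 2 * d₃ + d₂ - + 3 * d₁) + (+ 2 * (- q₃ - d₃ - n₃) + s₁ + + 5)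
        + (+ 2 * (- q₂ - d₂ - n₂) + s₀ + + 5) - (+ 2 * (- q₁ - d₁ - n₁) + s₁ + + 5)
  combine q₁ q₂ c d₁ d₂ d₃ d₄ s₀ s₁ n₁ refl refl refl refl refl refl =
    solve (q₁ ∷ q₂ ∷ c ∷ d₁ ∷ d₂ ∷ d₃ ∷ d₄ ∷ s₀ ∷ s₁ ∷ n₁ ∷ [])

corollary1p2 : (m : ℕ) → let n = suc m in
    (FFW 2 n ≡ Σ[1… n ∸ 1 ] (λ j → + d j) - + d n + + 1)
    × (+ 2 * FFW 3 n ≡ + 2 * (- Σ[1… n ∸ 1 ] (λ i → (+ ((n ∸ i ∸ 1) / 2) - + 1) * + d i) - + d n - + n) + sign n + + 5)
corollary1p2 m = FFW₂-formula m ,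
  third-order-agree (λ n → + 2 * FFW 3 (suc n)) (FFW₃-formula ∘ suc) FFW₃-next refl refl refl FFW₃-rec FFW₃-formula-rec m
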